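{- For every $(d,n)\in\mathbb{N}^2$ we have $m(c(n,d)) < m(c(n,d+1))$.
   Context: Words are finite words over the alphabet $\{a,b\}$. Let $A=\begin{pmatrix}1&1\\1&2\end{pmatrix}$ and $B=\begin{pmatrix}2&1\\1&1\end{pmatrix}$. For a word $w=x_1x_2\cdots x_k$ let $M^w=M^{x_1}\cdots M^{x_k}$ where $M^a=A$, $M^b=B$ (and $M^w=I$ for the empty word). The $m$-value of $w$ is $m(w)=\begin{pmatrix}1&0\end{pmatrix}M^w\begin{pmatrix}0\\1\end{pmatrix}$ (top-right entry of $M^w$). A word is identified with the lattice path in $\mathbb{N}^2$ from $(0,0)$ where $a$ is a step $(1,0)$ and $b$ a step $(0,1)$. For $(d,n)\in\mathbb{N}^2$, $c(n,d)$ is the unique lattice path from $(0,0)$ to $(d,n)$ that lies weakly below the segment from $(0,0)$ to $(d,n)$, contains every lattice point of this segment, and such that the region enclosed by the path and the segment contains no points of $\mathbb{N}^2$ other than those of the path (equivalently, the $\gcd(d,n)$-th power of the lower Christoffel word of slope $n/d$; $c(0,d)=a^d$, $c(n,0)=b^n$). -}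

module Defs where

open import Data.Nat using (ℕ; zero; suc; _+_; _*_; _≤_; _<_; _≤?_; _<?_)
open import Data.List using (List; []; _∷_; foldr)
open import Data.Product using (_×_; _,_)
open import Relation.Nullary using (yes; no)
open import Relation.Nullary.Decidable using (_×-dec_)

data Letter : Set where
  a b : Letter

Word : Set
Word = List Letter

record M2 : Set where
  constructor mat
  field
    m11 m12 m21 m22 : ℕ
open M2 public

_⊗_ : M2 → M2 → M2
mat p q r s ⊗ mat p' q' r' s' =
  mat (p * p' + q * r') (p * q' + q * s') (r * p' + s * r') (r * q' + s * s')

I₂ : M2
I₂ = mat 1 0 0 1

A B : M2
A = mat 1 1 1 2
B = mat 2 1 1 1

M^ : Letter → M2
M^ a = A
M^ b = B

Mw : Word → M2
Mw = foldr (λ x acc → M^ x ⊗ acc) I₂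

-- m(w) = (1 0) M^w (0 1)^T = top-right entry
m : Word → ℕ
m w = m12 (Mw w)

-- This is the highest lattice path weakly below the segment, i.e. the
-- lower Christoffel path described in the paper.
path : (n d : ℕ) → (fuel x y : ℕ) → Word
path n d zero x y = []
path n d (suc f) x y with (y <? n) ×-dec (suc y * d ≤? n * x)
... | yes _ = b ∷ path n d f x (suc y)
... | no _  = a ∷ path n d f (suc x) y

c : (n d : ℕ) → Word
c n d = path n d (d + n) 0 0

-- Encode a lattice path to (d,n) by the abscissae of its up steps; those of c(n,d) are ⌈jd/n⌉.
-- Inserting a letter a strictly increases m, and replacing a factor b a by a b does not decrease
-- it when the word is left-dominant around that factor, because A B − B A = [[0,−2],[2,0]].
-- Reflecting c(n,d) through the centre of its box preserves m and moves its up steps on the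
-- diagonal one unit right. The up steps that must move right to reach c(n,d+1) are then moved one
-- at a time, in increasing order of the slope ⌈jd/n⌉ / j: before each move the path hugs the line
-- through the origin and the moving step, so it is point-symmetric about the flipped square until
-- the symmetry breaks in the left-dominant direction. What remains is c(n,d+1) minus one letter a.

module Submission where

open import Defs
open import Data.Nat
  using (ℕ; zero; suc; _+_; _*_; _∸_; _⊓_; _≤_; _<_; _≰_; _≮_; z≤n; s≤s; s≤s⁻¹; _<?_; _≤?_; _≟_; >-nonZero)
open import Data.Nat.Properties
open import Algebra.Properties.CommutativeSemigroup *-commutativeSemigroup using (x∙yz≈y∙xz)
open import Data.Nat.DivMod using (_/_; _%_; m≡m%n+[m/n]*n; m%n<n; m<n*o⇒m/o<n)
open import Data.Nat.Tactic.RingSolver using (solve-∀)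
open import Data.List using ([]; _∷_; _++_; [_]; replicate; reverse)
open import Data.List.Properties using (++-assoc; ++-identityʳ; unfold-reverse; reverse-++)
open import Data.Product using (_×_; _,_; proj₁; proj₂; ∃-syntax)
open import Data.Sum using (_⊎_; inj₁; inj₂; [_,_]′)
open import Data.Empty using (⊥-elim)
open import Function using (_∘_)
open import Relation.Binary.Definitions using (tri<; tri≈; tri>)
open import Relation.Nullary using (¬_; Dec; yes; no)
open import Relation.Nullary.Decidable using (_×-dec_; _⊎-dec_; ¬?; decidable-stable)
open import Function.Bundles using (_⇔_; mk⇔; Equivalence)
open Equivalence using (to; from)
open import Relation.Binary.PropositionalEquality hiding ([_])

∸-suc : ∀ {m n} → m < n → n ∸ m ≡ suc (n ∸ suc m)
∸-suc m<n = +-∸-assoc 1 m<n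

m+n≡o+p⇒o∸m≡n∸p : ∀ m n o p → m + n ≡ o + p → o ∸ m ≡ n ∸ p
m+n≡o+p⇒o∸m≡n∸p m n o p eq = begin
  o ∸ m             ≡⟨ [m+n]∸[m+o]≡n∸o p o m ⟨
  p + o ∸ (p + m)   ≡⟨ cong₂ _∸_ (trans (+-comm p o) (sym eq)) (+-comm p m) ⟩
  m + n ∸ (m + p)   ≡⟨ [m+n]∸[m+o]≡n∸o m n p ⟩
  n ∸ p             ∎
  where open ≡-Reasoning

p+o<m+n⇒p∸n<m∸o : ∀ {m n o p} → o ≤ m → n ≤ p → p + o < m + n → p ∸ n < m ∸ o
p+o<m+n⇒p∸n<m∸o {m} {n} {o} {p} o≤m n≤p lt = +-cancelʳ-< (n + o) (p ∸ n) (m ∸ o) (begin-strict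
  p ∸ n + (n + o)   ≡⟨ ∸-+-cancel o n≤p ⟩
  p + o             <⟨ lt ⟩
  m + n             ≡⟨ ∸-+-cancel n o≤m ⟨
  m ∸ o + (o + n)   ≡⟨ cong (m ∸ o +_) (+-comm o n) ⟩
  m ∸ o + (n + o)   ∎)
  where
  open ≤-Reasoning
  ∸-+-cancel : ∀ {x y} z → y ≤ x → x ∸ y + (y + z) ≡ x + z
  ∸-+-cancel {x} {y} z y≤x = trans (sym (+-assoc (x ∸ y) y z)) (cong (_+ z) (m∸n+n≡m y≤x))

m<n*o⇒1≤o : ∀ {m} n o → m < n * o → 1 ≤ o
m<n*o⇒1≤o {m} n zero    m<n*0 = ⊥-elim (n≮0 (subst (m <_) (*-zeroʳ n) m<n*0))
m<n*o⇒1≤o     n (suc o) _     = s≤s z≤n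

floor-of : ∀ {Z m k} → (∀ y → Z ≤ y ⇔ m < k * y) → ∃[ p ] (Z ≡ suc p × k * p ≤ m × m < k * suc p)
floor-of {Z} {m} {k} Z≤⇔ = Z ∸ 1 , Z≡ , lower , subst (λ y → m < k * y) Z≡ upper
  where
  upper : m < k * Z
  upper = to (Z≤⇔ Z) ≤-refl
  Z≡ : Z ≡ suc (Z ∸ 1)
  Z≡ = sym (m+[n∸m]≡n (m<n*o⇒1≤o k Z upper))
  lower : k * (Z ∸ 1) ≤ m
  lower = ≮⇒≥ (λ lt → 1+n≰n (subst (_≤ Z ∸ 1) Z≡ (from (Z≤⇔ (Z ∸ 1)) lt)))

ceil-of : ∀ {Z m k} → 1 ≤ m → (∀ y → Z ≤ y ⇔ m ≤ k * y) →
          ∃[ q ] (Z ≡ suc q × k * q < m × m ≤ k * suc q)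
ceil-of {Z} {m} {k} 1≤m Z≤⇔ = Z ∸ 1 , Z≡ , lower , subst (λ y → m ≤ k * y) Z≡ upper
  where
  upper : m ≤ k * Z
  upper = to (Z≤⇔ Z) ≤-refl
  Z≡ : Z ≡ suc (Z ∸ 1)
  Z≡ = sym (m+[n∸m]≡n (m<n*o⇒1≤o k Z (<-≤-trans 1≤m upper)))
  lower : k * (Z ∸ 1) < m
  lower = ≰⇒> (λ le → 1+n≰n (subst (_≤ Z ∸ 1) Z≡ (from (Z≤⇔ (Z ∸ 1)) le)))

floor+ceil : ∀ {k p q s t D} → k * p ≤ s → s < k * suc p → k * q < t → t ≤ k * suc q →
             s + t ≡ k * D → suc p + suc q ≡ suc D
floor+ceil {k} {p} {q} {s} {t} {D} kp≤s s<kp′ kq<t t≤kq′ s+t≡ = cong suc (trans (+-suc p q)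
  (≤-antisym (*-cancelˡ-< k _ _ below) (subst (D ≤_) (+-suc p q) (s≤s⁻¹ (*-cancelˡ-< k _ _ above)))))
  where
  open ≤-Reasoning
  below : k * (p + q) < k * D
  below = begin-strict
    k * (p + q)           ≡⟨ *-distribˡ-+ k p q ⟩
    k * p + k * q         <⟨ +-mono-≤-< kp≤s kq<t ⟩
    s + t                 ≡⟨ s+t≡ ⟩
    k * D                 ∎
  above : k * D < k * (suc p + suc q)
  above = begin-strict
    k * D                 ≡⟨ s+t≡ ⟨
    s + t                 <⟨ +-mono-<-≤ s<kp′ t≤kq′ ⟩
    k * suc p + k * suc q ≡⟨ *-distribˡ-+ k (suc p) (suc q) ⟨
    k * (suc p + suc q)   ∎

-- Slopes compared crosswise: u/i against v/j against w/K.
cross-<≤ : ∀ u v w i j K → 1 ≤ K → j * u < i * v → K * v ≤ j * w → K * u < i * w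
cross-<≤ u v w i j K 1≤K ju<iv Kv≤jw = *-cancelˡ-< j _ _ (begin-strict
  j * (K * u) ≡⟨ x∙yz≈y∙xz j K u ⟩
  K * (j * u) <⟨ *-monoʳ-< K {{>-nonZero 1≤K}} ju<iv ⟩
  K * (i * v) ≡⟨ x∙yz≈y∙xz K i v ⟩
  i * (K * v) ≤⟨ *-monoʳ-≤ i Kv≤jw ⟩
  i * (j * w) ≡⟨ x∙yz≈y∙xz i j w ⟩
  j * (i * w) ∎)
  where open ≤-Reasoning

cross-≤< : ∀ u v w i j K → 1 ≤ i → j * u ≤ i * v → K * v < j * w → K * u < i * w
cross-≤< u v w i j K 1≤i ju≤iv Kv<jw = *-cancelˡ-< j _ _ (begin-strict
  j * (K * u) ≡⟨ x∙yz≈y∙xz j K u ⟩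
  K * (j * u) ≤⟨ *-monoʳ-≤ K ju≤iv ⟩
  K * (i * v) ≡⟨ x∙yz≈y∙xz K i v ⟩
  i * (K * v) <⟨ *-monoʳ-< i {{>-nonZero 1≤i}} Kv<jw ⟩
  i * (j * w) ≡⟨ x∙yz≈y∙xz i j w ⟩
  j * (i * w) ∎)
  where open ≤-Reasoning

cross-≡ : ∀ u v w i j K → 1 ≤ j → j * u ≡ i * v → K * v ≡ j * w → K * u ≡ i * w
cross-≡ u v w i j K 1≤j ju≡iv Kv≡jw = *-cancelˡ-≡ _ _ j {{>-nonZero 1≤j}} (begin
  j * (K * u) ≡⟨ x∙yz≈y∙xz j K u ⟩
  K * (j * u) ≡⟨ cong (K *_) ju≡iv ⟩
  K * (i * v) ≡⟨ x∙yz≈y∙xz K i v ⟩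
  i * (K * v) ≡⟨ cong (i *_) Kv≡jw ⟩
  i * (j * w) ≡⟨ x∙yz≈y∙xz i j w ⟩
  j * (i * w) ∎)
  where open ≡-Reasoning

⌈_/suc_⌉ : ℕ → ℕ → ℕ
⌈ m /suc n ⌉ = (m + n) / suc n

⌈/suc⌉≤⇔ : ∀ m n y → ⌈ m /suc n ⌉ ≤ y ⇔ m ≤ suc n * y
⌈/suc⌉≤⇔ m n y = mk⇔ bound exact
  where
  bound : ⌈ m /suc n ⌉ ≤ y → m ≤ suc n * y
  bound q≤y = +-cancelʳ-≤ n m (suc n * y) (begin
    m + n                                    ≡⟨ m≡m%n+[m/n]*n (m + n) (suc n) ⟩
    (m + n) % suc n + ⌈ m /suc n ⌉ * suc n   ≤⟨ +-mono-≤ (s≤s⁻¹ (m%n<n (m + n) (suc n)))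
                                                         (*-monoˡ-≤ (suc n) q≤y) ⟩
    n + y * suc n                            ≡⟨ trans (+-comm n _) (cong (_+ n) (*-comm y (suc n))) ⟩
    suc n * y + n                            ∎)
    where open ≤-Reasoning
  exact : m ≤ suc n * y → ⌈ m /suc n ⌉ ≤ y
  exact m≤ = s≤s⁻¹ (m<n*o⇒m/o<n (begin-strict
    m + n                ≤⟨ +-monoˡ-≤ n m≤ ⟩
    suc n * y + n        <⟨ +-monoʳ-< (suc n * y) (n<1+n n) ⟩
    suc n * y + suc n    ≡⟨ trans (+-comm _ (suc n)) (cong (suc n +_) (*-comm (suc n) y)) ⟩
    suc y * suc n        ∎))
    where open ≤-Reasoning

crossing : ∀ (f : ℕ → ℕ) D M → f 0 ≤ D → D < f M → ∃[ j ] (j < M × f j ≤ D × D < f (suc j))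
crossing f D zero    f0≤D D<f0 = ⊥-elim (<-irrefl refl (<-≤-trans D<f0 f0≤D))
crossing f D (suc M) f0≤D D<fM with f M ≤? D
... | yes fM≤D = M , ≤-refl , fM≤D , D<fM
... | no  fM≰D with crossing f D M f0≤D (≰⇒> fM≰D)
...   | j , j<M , fj≤D , D<fsj = j , m<n⇒m<1+n j<M , fj≤D , D<fsj

𝟙 : ∀ {P : Set} → Dec P → ℕ
𝟙 (yes _) = 1
𝟙 (no  _) = 0

𝟙-yes : ∀ {P : Set} (P? : Dec P) → P → 𝟙 P? ≡ 1
𝟙-yes (yes _) _ = refl
𝟙-yes (no ¬p) p = ⊥-elim (¬p p)

𝟙-no : ∀ {P : Set} (P? : Dec P) → ¬ P → 𝟙 P? ≡ 0
𝟙-no (yes p) ¬p = ⊥-elim (¬p p)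
𝟙-no (no _)  _  = refl

𝟙-mono : ∀ {P Q : Set} (P? : Dec P) (Q? : Dec Q) → (P → Q) → 𝟙 P? ≤ 𝟙 Q?
𝟙-mono (yes p) Q? P→Q = ≤-reflexive (sym (𝟙-yes Q? (P→Q p)))
𝟙-mono (no _)  _  _   = z≤n

𝟙-cong : ∀ {P Q : Set} (P? : Dec P) (Q? : Dec Q) → P ⇔ Q → 𝟙 P? ≡ 𝟙 Q?
𝟙-cong P? Q? P⇔Q = ≤-antisym (𝟙-mono P? Q? (to P⇔Q)) (𝟙-mono Q? P? (from P⇔Q))

sumTo : (ℕ → ℕ) → ℕ → ℕ
sumTo f zero    = 0
sumTo f (suc J) = sumTo f J + f (suc J)

Pointwise≤ : (ℕ → ℕ) → (ℕ → ℕ) → ℕ → Set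
Pointwise≤ f g J = ∀ j → 1 ≤ j → j ≤ J → f j ≤ g j

pointwise≤-pred : ∀ {f g} J → Pointwise≤ f g (suc J) → Pointwise≤ f g J
pointwise≤-pred J f≤g j 1≤j j≤J = f≤g j 1≤j (m≤n⇒m≤1+n j≤J)

sumTo-mono-≤ : ∀ {f g} J → Pointwise≤ f g J → sumTo f J ≤ sumTo g J
sumTo-mono-≤ zero    _   = z≤n
sumTo-mono-≤ (suc J) f≤g = +-mono-≤ (sumTo-mono-≤ J (pointwise≤-pred J f≤g)) (f≤g (suc J) (s≤s z≤n) ≤-refl)

sumTo-mono-< : ∀ {f g} J {k} → 1 ≤ k → k ≤ J → Pointwise≤ f g J → f k < g k → sumTo f J < sumTo g J
sumTo-mono-< zero    1≤k k≤0 _ _ = ⊥-elim (<-irrefl refl (≤-trans 1≤k k≤0))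
sumTo-mono-< (suc J) 1≤k k≤J f≤g fk<gk with m≤n⇒m<n∨m≡n k≤J
... | inj₁ k<1+J = +-mono-<-≤ (sumTo-mono-< J 1≤k (s≤s⁻¹ k<1+J) (pointwise≤-pred J f≤g) fk<gk)
                              (f≤g (suc J) (s≤s z≤n) ≤-refl)
... | inj₂ refl  = +-mono-≤-< (sumTo-mono-≤ J (pointwise≤-pred J f≤g)) fk<gk

below-suc : ∀ {R : ℕ → Set} {N} → (∀ j → j < N → R j) → R N → ∀ j → j < suc N → R j
below-suc below atN j j<1+N with m≤n⇒m<n∨m≡n (s≤s⁻¹ j<1+N)
... | inj₁ j<N = below j j<N
... | inj₂ refl = atN

module Minimal {P : ℕ → Set} (P? : ∀ j → Dec (P j)) {_≺_ : ℕ → ℕ → Set} (≺? : ∀ i j → Dec (i ≺ j))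
  (≺-irrefl : ∀ {i} → ¬ i ≺ i) (≺-trans : ∀ {i j l} → P i → P j → P l → i ≺ j → j ≺ l → i ≺ l) where

  minimal : ∀ N → (∀ j → j < N → ¬ P j) ⊎ ∃[ k ] (k < N × P k × ∀ j → j < N → P j → ¬ j ≺ k)
  minimal zero = inj₁ (λ _ ())
  minimal (suc N) with minimal N | P? N
  ... | inj₁ none | no ¬pN = inj₁ (below-suc none ¬pN)
  ... | inj₁ none | yes pN = inj₂ (N , ≤-refl , pN , below-suc (λ j j<N pj _ → none j j<N pj) (λ _ → ≺-irrefl))
  ... | inj₂ (k , k<N , pk , least) | no ¬pN =
    inj₂ (k , m<n⇒m<1+n k<N , pk , below-suc least (⊥-elim ∘ ¬pN))
  ... | inj₂ (k , k<N , pk , least) | yes pN with ≺? N k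
  ...   | yes N≺k = inj₂ (N , ≤-refl , pN ,
                          below-suc (λ j j<N pj j≺N → least j j<N pj (≺-trans pj pN pk j≺N N≺k)) (λ _ → ≺-irrefl))
  ...   | no  N⊀k = inj₂ (k , m<n⇒m<1+n k<N , pk , below-suc least (λ _ → N⊀k))

-- Matrices and m-values

mat-cong : ∀ {p q r s p′ q′ r′ s′} →
           p ≡ p′ → q ≡ q′ → r ≡ r′ → s ≡ s′ → mat p q r s ≡ mat p′ q′ r′ s′
mat-cong refl refl refl refl = refl

⊗-assoc : ∀ X Y Z → (X ⊗ Y) ⊗ Z ≡ X ⊗ (Y ⊗ Z)
⊗-assoc (mat p q r s) (mat e f g h) (mat i j k l) =
  mat-cong (entry p q e f g h i k) (entry p q e f g h j l)
           (entry r s e f g h i k) (entry r s e f g h j l)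
  where
  entry : ∀ p q e f g h i k →
          (p * e + q * g) * i + (p * f + q * h) * k ≡ p * (e * i + f * k) + q * (g * i + h * k)
  entry = solve-∀

⊗-identityˡ : ∀ X → I₂ ⊗ X ≡ X
⊗-identityˡ (mat p q r s) = mat-cong (first p r) (first q s) (second p r) (second q s)
  where
  first : ∀ x y → 1 * x + 0 * y ≡ x
  first = solve-∀
  second : ∀ x y → 0 * x + 1 * y ≡ y
  second = solve-∀

⊗-identityʳ : ∀ X → X ⊗ I₂ ≡ X
⊗-identityʳ (mat p q r s) = mat-cong (first p q) (second p q) (first r s) (second r s)
  where
  first : ∀ x y → x * 1 + y * 0 ≡ x
  first = solve-∀
  second : ∀ x y → x * 0 + y * 1 ≡ y
  second = solve-∀

Mw-++ : ∀ u v → Mw (u ++ v) ≡ Mw u ⊗ Mw v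
Mw-++ []      v = sym (⊗-identityˡ (Mw v))
Mw-++ (x ∷ u) v = trans (cong (M^ x ⊗_) (Mw-++ u v)) (sym (⊗-assoc (M^ x) (Mw u) (Mw v)))

Mw-∷ʳ : ∀ u x → Mw (u ++ [ x ]) ≡ Mw u ⊗ M^ x
Mw-∷ʳ u x = trans (Mw-++ u [ x ]) (cong (Mw u ⊗_) (⊗-identityʳ (M^ x)))

m11-Mw-pos : ∀ w → 1 ≤ m11 (Mw w)
m11-Mw-pos []      = s≤s z≤n
m11-Mw-pos (a ∷ w) = ≤-trans (m11-Mw-pos w) (≤-trans (m≤n*m _ 1) (m≤m+n _ _))
m11-Mw-pos (b ∷ w) = ≤-trans (m11-Mw-pos w) (≤-trans (m≤n*m _ 2) (m≤m+n _ _))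

m22-Mw-pos : ∀ w → 1 ≤ m22 (Mw w)
m22-Mw-pos []      = s≤s z≤n
m22-Mw-pos (a ∷ w) = ≤-trans (m22-Mw-pos w) (≤-trans (m≤n*m _ 2) (m≤n+m _ (1 * m12 (Mw w))))
m22-Mw-pos (b ∷ w) = ≤-trans (m22-Mw-pos w) (≤-trans (m≤n*m _ 1) (m≤n+m _ (1 * m12 (Mw w))))

m-++ : ∀ u v → m (u ++ v) ≡ m11 (Mw u) * m12 (Mw v) + m12 (Mw u) * m22 (Mw v)
m-++ u v = cong m12 (Mw-++ u v)

m-insert-a : ∀ u v → m (u ++ v) < m (u ++ a ∷ v)
m-insert-a u v = begin-strict
  m (u ++ v)                                   ≡⟨ m-++ u v ⟩
  p₁ * q₁ + p₂ * q₂                            <⟨ m<m+n _ (≤-trans p₁q₂-pos (m≤m+n _ _)) ⟩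
  p₁ * q₁ + p₂ * q₂ + (p₁ * q₂ + p₂ * (q₁ + q₂)) ≡⟨ expand p₁ p₂ q₁ q₂ ⟩
  p₁ * (1 * q₁ + 1 * q₂) + p₂ * (1 * q₁ + 2 * q₂) ≡⟨ m-++ u (a ∷ v) ⟨
  m (u ++ a ∷ v)                               ∎
  where
  open ≤-Reasoning
  p₁ p₂ q₁ q₂ : ℕ
  p₁ = m11 (Mw u); p₂ = m12 (Mw u); q₁ = m12 (Mw v); q₂ = m22 (Mw v)
  p₁q₂-pos : 1 ≤ p₁ * q₂
  p₁q₂-pos = *-mono-≤ (m11-Mw-pos u) (m22-Mw-pos v)
  expand : ∀ p₁ p₂ q₁ q₂ → p₁ * q₁ + p₂ * q₂ + (p₁ * q₂ + p₂ * (q₁ + q₂)) ≡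
                           p₁ * (1 * q₁ + 1 * q₂) + p₂ * (1 * q₁ + 2 * q₂)
  expand = solve-∀

-- m (u ++ a ∷ b ∷ v) − m (u ++ b ∷ a ∷ v) = 2 (m12 P · m12 Q − m11 P · m22 Q) for P = Mw u and
-- Q = Mw v, because A B − B A = [[0,−2],[2,0]].
Swappable : Word → Word → Set
Swappable u v = m11 (Mw u) * m22 (Mw v) ≤ m12 (Mw u) * m12 (Mw v)

m-swap : ∀ u v → Swappable u v → m (u ++ b ∷ a ∷ v) ≤ m (u ++ a ∷ b ∷ v)
m-swap u v swappable = +-cancelʳ-≤ (2 * (p₂ * q₁)) _ _ (begin
  m (u ++ b ∷ a ∷ v) + 2 * (p₂ * q₁) ≡⟨ commutator ⟩
  m (u ++ a ∷ b ∷ v) + 2 * (p₁ * q₂) ≤⟨ +-monoʳ-≤ (m (u ++ a ∷ b ∷ v)) (*-monoʳ-≤ 2 swappable) ⟩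
  m (u ++ a ∷ b ∷ v) + 2 * (p₂ * q₁) ∎)
  where
  open ≤-Reasoning
  p₁ p₂ q₁ q₂ : ℕ
  p₁ = m11 (Mw u); p₂ = m12 (Mw u); q₁ = m12 (Mw v); q₂ = m22 (Mw v)
  identity : ∀ p₁ p₂ q₁ q₂ →
    p₁ * (2 * (1 * q₁ + 1 * q₂) + 1 * (1 * q₁ + 2 * q₂)) +
    p₂ * (1 * (1 * q₁ + 1 * q₂) + 1 * (1 * q₁ + 2 * q₂)) + 2 * (p₂ * q₁)
    ≡ p₁ * (1 * (2 * q₁ + 1 * q₂) + 1 * (1 * q₁ + 1 * q₂)) +
      p₂ * (1 * (2 * q₁ + 1 * q₂) + 2 * (1 * q₁ + 1 * q₂)) + 2 * (p₁ * q₂)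
  identity = solve-∀
  commutator : m (u ++ b ∷ a ∷ v) + 2 * (p₂ * q₁) ≡ m (u ++ a ∷ b ∷ v) + 2 * (p₁ * q₂)
  commutator rewrite m-++ u (b ∷ a ∷ v) | m-++ u (a ∷ b ∷ v) = identity p₁ p₂ q₁ q₂

swappable-a-b : ∀ u v → Swappable (u ++ [ a ]) (b ∷ v)
swappable-a-b u v rewrite Mw-∷ʳ u a =
  ≤-trans (m≤m+n _ _) (≤-reflexive (identity (m11 (Mw u)) (m12 (Mw u)) (m12 (Mw v)) (m22 (Mw v))))
  where
  identity : ∀ p₁ p₂ q₁ q₂ →
    (p₁ * 1 + p₂ * 1) * (1 * q₁ + 1 * q₂) + (p₁ * q₁ + 3 * (p₂ * q₁) + p₂ * q₂)
    ≡ (p₁ * 1 + p₂ * 2) * (2 * q₁ + 1 * q₂)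
  identity = solve-∀

swappable-extend : ∀ x u v → Swappable u v → Swappable (u ++ [ x ]) (x ∷ v)
swappable-extend x u v swappable rewrite Mw-∷ʳ u x =
  +-cancelʳ-≤ (p₂ * q₁) _ _ (≤-trans (≤-reflexive (identity x)) (+-monoʳ-≤ _ swappable))
  where
  p₁ p₂ q₁ q₂ : ℕ
  p₁ = m11 (Mw u); p₂ = m12 (Mw u); q₁ = m12 (Mw v); q₂ = m22 (Mw v)
  identityᵃ : ∀ p₁ p₂ q₁ q₂ → (p₁ * 1 + p₂ * 1) * (1 * q₁ + 2 * q₂) + p₂ * q₁
                              ≡ (p₁ * 1 + p₂ * 2) * (1 * q₁ + 1 * q₂) + p₁ * q₂
  identityᵃ = solve-∀
  identityᵇ : ∀ p₁ p₂ q₁ q₂ → (p₁ * 2 + p₂ * 1) * (1 * q₁ + 1 * q₂) + p₂ * q₁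
                              ≡ (p₁ * 1 + p₂ * 1) * (2 * q₁ + 1 * q₂) + p₁ * q₂
  identityᵇ = solve-∀
  identity : ∀ x → m11 (Mw u ⊗ M^ x) * m22 (M^ x ⊗ Mw v) + p₂ * q₁
                   ≡ m12 (Mw u ⊗ M^ x) * m12 (M^ x ⊗ Mw v) + p₁ * q₂
  identity a = identityᵃ p₁ p₂ q₁ q₂
  identity b = identityᵇ p₁ p₂ q₁ q₂

a^_ : ℕ → Word

a^ r = replicate r a

a^-comm : ∀ r w → a^ r ++ a ∷ w ≡ a ∷ a^ r ++ w
a^-comm zero    w = refl
a^-comm (suc r) w = cong (a ∷_) (a^-comm r w)

swappable-extend-a^ : ∀ r u v → Swappable u v → Swappable (u ++ a^ r) (a^ r ++ v)
swappable-extend-a^ zero    u v swappable = subst (λ u → Swappable u v) (sym (++-identityʳ u)) swappable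
swappable-extend-a^ (suc r) u v swappable =
  subst₂ Swappable (++-assoc u [ a ] (a^ r)) (a^-comm r v)
    (swappable-extend-a^ r (u ++ [ a ]) (a ∷ v) (swappable-extend a u v swappable))

transpose : M2 → M2
transpose (mat p q r s) = mat p r q s

transpose-⊗ : ∀ X Y → transpose (X ⊗ Y) ≡ transpose Y ⊗ transpose X
transpose-⊗ (mat p q r s) (mat e f g h) =
  mat-cong (swap p e q g) (swap r e s g) (swap p f q h) (swap r f s h)
  where
  swap : ∀ x y z w → x * y + z * w ≡ y * x + w * z
  swap = solve-∀

transpose-M^ : ∀ x → transpose (M^ x) ≡ M^ x
transpose-M^ a = refl
transpose-M^ b = refl

Mw-reverse : ∀ w → Mw (reverse w) ≡ transpose (Mw w)
Mw-reverse []      = refl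
Mw-reverse (x ∷ w) = begin
  Mw (reverse (x ∷ w))                ≡⟨ cong Mw (unfold-reverse x w) ⟩
  Mw (reverse w ++ [ x ])             ≡⟨ Mw-∷ʳ (reverse w) x ⟩
  Mw (reverse w) ⊗ M^ x               ≡⟨ cong₂ _⊗_ (Mw-reverse w) (sym (transpose-M^ x)) ⟩
  transpose (Mw w) ⊗ transpose (M^ x) ≡⟨ transpose-⊗ (M^ x) (Mw w) ⟨
  transpose (M^ x ⊗ Mw w)             ∎
  where open ≡-Reasoning

entrySum : M2 → ℕ
entrySum (mat p q r s) = p + q + r + s

m-a∷-∷ʳb : ∀ w → m (a ∷ w ++ [ b ]) ≡ entrySum (Mw w)
m-a∷-∷ʳb w = trans (cong (λ X → m12 (A ⊗ X)) (Mw-∷ʳ w b))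
                   (identity (m11 (Mw w)) (m12 (Mw w)) (m21 (Mw w)) (m22 (Mw w)))
  where
  identity : ∀ p q r s → 1 * (p * 1 + q * 1) + 1 * (r * 1 + s * 1) ≡ p + q + r + s
  identity = solve-∀

m-a∷reverse-∷ʳb : ∀ w → m (a ∷ reverse w ++ [ b ]) ≡ m (a ∷ w ++ [ b ])
m-a∷reverse-∷ʳb w = begin
  m (a ∷ reverse w ++ [ b ])  ≡⟨ m-a∷-∷ʳb (reverse w) ⟩
  entrySum (Mw (reverse w))   ≡⟨ cong entrySum (Mw-reverse w) ⟩
  entrySum (transpose (Mw w)) ≡⟨ middle (m11 (Mw w)) (m12 (Mw w)) (m21 (Mw w)) (m22 (Mw w)) ⟩
  entrySum (Mw w)             ≡⟨ m-a∷-∷ʳb w ⟨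
  m (a ∷ w ++ [ b ])          ∎
  where
  open ≡-Reasoning
  middle : ∀ p q r s → p + r + q + s ≡ p + q + r + s
  middle = solve-∀

a^-∷ʳ : ∀ r → a^ suc r ≡ a^ r ++ [ a ]
a^-∷ʳ zero    = refl
a^-∷ʳ (suc r) = cong (a ∷_) (a^-∷ʳ r)

reverse-a^ : ∀ r → reverse (a^ r) ≡ a^ r
reverse-a^ zero    = refl
reverse-a^ (suc r) = begin
  reverse (a ∷ a^ r)     ≡⟨ unfold-reverse a (a^ r) ⟩
  reverse (a^ r) ++ [ a ] ≡⟨ cong (_++ [ a ]) (reverse-a^ r) ⟩
  a^ r ++ [ a ]           ≡⟨ a^-∷ʳ r ⟨
  a^ suc r                ∎
  where open ≡-Reasoning

gapWord : (ℕ → ℕ) → ℕ → Word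
gapWord g zero    = a^ g 0
gapWord g (suc n) = a^ g 0 ++ b ∷ gapWord (g ∘ suc) n

gapWord-cong : ∀ n {g h} → (∀ i → i ≤ n → g i ≡ h i) → gapWord g n ≡ gapWord h n
gapWord-cong zero    g≗h = cong a^_ (g≗h 0 z≤n)
gapWord-cong (suc n) g≗h =
  cong₂ (λ r w → a^ r ++ b ∷ w) (g≗h 0 z≤n) (gapWord-cong n (λ i i≤n → g≗h (suc i) (s≤s i≤n)))

gapWord-∷ʳ : ∀ n g → gapWord g (suc n) ≡ gapWord g n ++ b ∷ a^ g (suc n)
gapWord-∷ʳ zero    g = refl
gapWord-∷ʳ (suc n) g = trans (cong (λ w → a^ g 0 ++ b ∷ w) (gapWord-∷ʳ n (g ∘ suc)))
                             (sym (++-assoc (a^ g 0) (b ∷ gapWord (g ∘ suc) n) _))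

gapWord-last : ∀ n g → ∃[ w ] gapWord g n ≡ w ++ a^ g n
gapWord-last zero    g = [] , refl
gapWord-last (suc n) g = gapWord g n ++ [ b ] ,
  trans (gapWord-∷ʳ n g) (sym (++-assoc (gapWord g n) [ b ] (a^ g (suc n))))

gapWord-reverse : ∀ n g → reverse (gapWord g n) ≡ gapWord (λ i → g (n ∸ i)) n
gapWord-reverse zero    g = reverse-a^ (g 0)
gapWord-reverse (suc n) g = begin
  reverse (a^ g 0 ++ b ∷ gapWord (g ∘ suc) n)
    ≡⟨ reverse-++ (a^ g 0) (b ∷ gapWord (g ∘ suc) n) ⟩
  reverse (b ∷ gapWord (g ∘ suc) n) ++ reverse (a^ g 0)
    ≡⟨ cong₂ _++_ (unfold-reverse b (gapWord (g ∘ suc) n)) (reverse-a^ (g 0)) ⟩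
  (reverse (gapWord (g ∘ suc) n) ++ [ b ]) ++ a^ g 0
    ≡⟨ ++-assoc (reverse (gapWord (g ∘ suc) n)) [ b ] (a^ g 0) ⟩
  reverse (gapWord (g ∘ suc) n) ++ b ∷ a^ g 0
    ≡⟨ cong₂ (λ w r → w ++ b ∷ a^ r) (trans (gapWord-reverse n (g ∘ suc)) reindex)
                                       (cong g (sym (n∸n≡0 (suc n)))) ⟩
  gapWord (λ i → g (suc n ∸ i)) n ++ b ∷ a^ g (suc n ∸ suc n)
    ≡⟨ gapWord-∷ʳ n (λ i → g (suc n ∸ i)) ⟨
  gapWord (λ i → g (suc n ∸ i)) (suc n) ∎
  where
  open ≡-Reasoning
  reindex : gapWord (λ i → g (suc (n ∸ i))) n ≡ gapWord (λ i → g (suc n ∸ i)) n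
  reindex = gapWord-cong n (λ i i≤n → cong g (sym (+-∸-assoc 1 i≤n)))

gapWord-inc-head : ∀ n {g g′} → g′ 0 ≡ suc (g 0) → (∀ i → i < n → g′ (suc i) ≡ g (suc i)) →
                   gapWord g′ n ≡ a ∷ gapWord g n
gapWord-inc-head zero    g′0 _    = cong a^_ g′0
gapWord-inc-head (suc n) g′0 same =
  cong₂ (λ r w → a^ r ++ b ∷ w) g′0 (gapWord-cong n (λ i i≤n → same i (s≤s i≤n)))

gapWord-insert : ∀ n j {g g′} → j ≤ n → g′ j ≡ suc (g j) →
                 (∀ i → i ≤ n → i ≢ j → g′ i ≡ g i) →
                 ∃[ u ] ∃[ v ] gapWord g n ≡ u ++ v × gapWord g′ n ≡ u ++ a ∷ v
gapWord-insert n zero {g} _ g′0 same =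
  [] , gapWord g n , refl , gapWord-inc-head n g′0 (λ i i≤n → same (suc i) i≤n (λ ()))
gapWord-insert (suc n) (suc j) {g} {g′} (s≤s j≤n) g′j same
  with gapWord-insert n j {g ∘ suc} {g′ ∘ suc} j≤n g′j
         (λ i i≤n i≢j → same (suc i) (s≤s i≤n) (i≢j ∘ suc-injective))
... | u , v , eq , eq′ =
  a^ g 0 ++ b ∷ u , v ,
  trans (cong (λ w → a^ g 0 ++ b ∷ w) eq) (sym (++-assoc (a^ g 0) (b ∷ u) v)) ,
  trans (cong₂ (λ r w → a^ r ++ b ∷ w) (same 0 z≤n (λ ())) eq′)
        (sym (++-assoc (a^ g 0) (b ∷ u) (a ∷ v)))

m-gapWord-insert : ∀ n j {g g′} → j ≤ n → g′ j ≡ suc (g j) →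
                   (∀ i → i ≤ n → i ≢ j → g′ i ≡ g i) → m (gapWord g n) < m (gapWord g′ n)
m-gapWord-insert n j j≤n g′j same with gapWord-insert n j j≤n g′j same
... | u , v , eq , eq′ = subst₂ _<_ (cong m (sym eq)) (cong m (sym eq′)) (m-insert-a u v)

gapWord-swap : ∀ K r {g g′} → g′ K ≡ suc (g K) → g (suc K) ≡ suc (g′ (suc K)) →
  (∀ i → i ≢ K → i ≢ suc K → g′ i ≡ g i) →
  let Q = gapWord (λ i → g′ (suc K + i)) r in
  gapWord g (K + suc r) ≡ gapWord g K ++ b ∷ a ∷ Q × gapWord g′ (K + suc r) ≡ gapWord g K ++ a ∷ b ∷ Q
gapWord-swap zero r {g} {g′} g′0 g1 same =
  cong (λ w → a^ g 0 ++ b ∷ w) (gapWord-inc-head r g1 (λ i _ → sym (same (suc (suc i)) (λ ()) (λ ())))) ,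
  trans (cong (λ x → a^ x ++ b ∷ gapWord (g′ ∘ suc) r) g′0) (sym (a^-comm (g 0) _))
gapWord-swap (suc K) r {g} {g′} g′K gK same
  with gapWord-swap K r {g ∘ suc} {g′ ∘ suc} g′K gK
         (λ i i≢K i≢1+K → same (suc i) (i≢K ∘ suc-injective) (i≢1+K ∘ suc-injective))
... | eq , eq′ =
  trans (cong (λ w → a^ g 0 ++ b ∷ w) eq) (sym (++-assoc (a^ g 0) (b ∷ _) _)) ,
  trans (cong₂ (λ x w → a^ x ++ b ∷ w) (same 0 (λ ()) (λ ())) eq′) (sym (++-assoc (a^ g 0) (b ∷ _) _))

m-gapWord-swap : ∀ K r {g g′} → g′ K ≡ suc (g K) → g (suc K) ≡ suc (g′ (suc K)) →
  (∀ i → i ≢ K → i ≢ suc K → g′ i ≡ g i) →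
  Swappable (gapWord g K) (gapWord (λ i → g′ (suc K + i)) r) →
  m (gapWord g (K + suc r)) ≤ m (gapWord g′ (K + suc r))
m-gapWord-swap K r {g} {g′} g′K gK same swappable with gapWord-swap K r {g} {g′} g′K gK same
... | eq , eq′ = subst₂ _≤_ (cong m (sym eq)) (cong m (sym eq′)) (m-swap (gapWord g K) _ swappable)

-- Reading gapWord g u backwards and gapWord r (suc v) forwards, the first runs of a's that
-- differ are longer on the left, and this happens before the right word reaches its last run.
LeftDominant : (g : ℕ → ℕ) → ℕ → (r : ℕ → ℕ) → ℕ → Set
LeftDominant g zero    r v       = r 0 < g 0
LeftDominant g (suc u) r zero    = r 0 < g (suc u)
LeftDominant g (suc u) r (suc v) = r 0 < g (suc u) ⊎ (r 0 ≡ g (suc u) × LeftDominant g u (r ∘ suc) v)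

leftDominant-< : ∀ u v {g r} → r 0 < g u → LeftDominant g u r v
leftDominant-< zero    v       r0<g = r0<g
leftDominant-< (suc u) zero    r0<g = r0<g
leftDominant-< (suc u) (suc v) r0<g = inj₁ r0<g

swappable-longer-run : ∀ B t w v → Swappable (w ++ a^ (suc B + t)) (a^ B ++ b ∷ v)
swappable-longer-run zero    t w v =
  subst (λ w′ → Swappable w′ (b ∷ v)) (trans (++-assoc w (a^ t) [ a ]) (cong (w ++_) (sym (a^-∷ʳ t))))
    (swappable-a-b (w ++ a^ t) v)
swappable-longer-run (suc B) t w v =
  subst (λ w′ → Swappable w′ (a^ suc B ++ b ∷ v))
        (trans (++-assoc w (a^ (suc B + t)) [ a ]) (cong (w ++_) (sym (a^-∷ʳ (suc B + t)))))
    (swappable-extend a (w ++ a^ (suc B + t)) (a^ B ++ b ∷ v) (swappable-longer-run B t w v))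

swappable-run< : ∀ u g v r → r 0 < g u → Swappable (gapWord g u) (gapWord r (suc v))
swappable-run< u g v r r0<gu with gapWord-last u g | m≤n⇒∃[o]m+o≡n r0<gu
... | w , eq | t , gu≡ = subst (λ w′ → Swappable w′ (gapWord r (suc v)))
                                (trans (cong (λ x → w ++ a^ x) gu≡) (sym eq)) (swappable-longer-run (r 0) t w _)

swappable-leftDominant : ∀ u g v r → LeftDominant g u r v → Swappable (gapWord g u) (gapWord r (suc v))
swappable-leftDominant zero    g v       r r0<g0        = swappable-run< zero g v r r0<g0
swappable-leftDominant (suc u) g zero    r r0<gu        = swappable-run< (suc u) g zero r r0<gu
swappable-leftDominant (suc u) g (suc v) r (inj₁ r0<gu) = swappable-run< (suc u) g (suc v) r r0<gu
swappable-leftDominant (suc u) g (suc v) r (inj₂ (r0≡gu , rest)) =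
  subst (λ w → Swappable w (gapWord r (suc (suc v))))
    (trans (++-assoc (gapWord g u) [ b ] (a^ r 0))
           (trans (cong (λ x → gapWord g u ++ b ∷ a^ x) r0≡gu) (sym (gapWord-∷ʳ u g))))
    (swappable-extend-a^ (r 0) (gapWord g u ++ [ b ]) (b ∷ gapWord (r ∘ suc) (suc v))
      (swappable-extend b (gapWord g u) (gapWord (r ∘ suc) (suc v)) (swappable-leftDominant u g v (r ∘ suc) rest)))

-- Lattice paths

-- Y j (1 ≤ j ≤ n) is the abscissa of the j-th up step of a lattice path from (0,0) to (d,n);
-- the words are only meaningful when Y 0 = 0.
next : (ℕ → ℕ) → ℕ → ℕ → ℕ → ℕ
next Y n d i with i <? n
... | yes _ = Y (suc i)
... | no  _ = d

gap : (ℕ → ℕ) → ℕ → ℕ → ℕ → ℕ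
gap Y n d i = next Y n d i ∸ Y i

pathWord : (ℕ → ℕ) → ℕ → ℕ → Word
pathWord Y n d = gapWord (gap Y n d) n

next-< : ∀ Y n d {i} → i < n → next Y n d i ≡ Y (suc i)
next-< Y n d {i} i<n with i <? n
... | yes _   = refl
... | no  i≮n = ⊥-elim (i≮n i<n)

next-≥ : ∀ Y n d {i} → n ≤ i → next Y n d i ≡ d
next-≥ Y n d {i} n≤i with i <? n
... | yes i<n = ⊥-elim (<-irrefl refl (<-≤-trans i<n n≤i))
... | no  _   = refl

gap-< : ∀ Y n d {i} → i < n → gap Y n d i ≡ Y (suc i) ∸ Y i
gap-< Y n d i<n = cong (_∸ Y _) (next-< Y n d i<n)

gap-≥ : ∀ Y n d {i} → n ≤ i → gap Y n d i ≡ d ∸ Y i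
gap-≥ Y n d n≤i = cong (_∸ Y _) (next-≥ Y n d n≤i)

next-cong : ∀ {Y Y′} n d i → (i < n → Y′ (suc i) ≡ Y (suc i)) → next Y′ n d i ≡ next Y n d i
next-cong n d i same with i <? n
... | yes i<n = same i<n
... | no  _   = refl

pathWord-cong : ∀ n d {Y Y′} → (∀ j → j ≤ n → Y′ j ≡ Y j) → pathWord Y′ n d ≡ pathWord Y n d
pathWord-cong n d same = gapWord-cong n (λ i i≤n →
  cong₂ _∸_ (next-cong n d i (λ i<n → same (suc i) i<n)) (same i i≤n))

module CeilingPath (n d : ℕ) (Y : ℕ → ℕ) (Y≤⇔ : ∀ j x → j ≤ n → Y j ≤ x ⇔ j * d ≤ n * x) where

  Y0≡0 : Y 0 ≡ 0
  Y0≡0 = n≤0⇒n≡0 (from (Y≤⇔ 0 0 z≤n) z≤n)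

  Y-mono : ∀ {i j} → i ≤ j → j ≤ n → Y i ≤ Y j
  Y-mono i≤j j≤n =
    from (Y≤⇔ _ _ (≤-trans i≤j j≤n)) (≤-trans (*-monoˡ-≤ d i≤j) (to (Y≤⇔ _ _ j≤n) ≤-refl))

  Y≤d : ∀ {j} → j ≤ n → Y j ≤ d
  Y≤d j≤n = from (Y≤⇔ _ _ j≤n) (*-monoˡ-≤ d j≤n)

  next≤d : ∀ j → next Y n d j ≤ d
  next≤d j with j <? n
  ... | yes j<n = Y≤d j<n
  ... | no  _   = ≤-refl

  -- the word still to be read from a point (x , j) on the j-th horizontal run
  rest : ℕ → ℕ → ℕ → ℕ
  rest x j zero    = next Y n d j ∸ x
  rest x j (suc i) = gap Y n d (j + suc i)

  path≡rest : ∀ f x j → f ≡ (d ∸ x) + (n ∸ j) → x ≤ next Y n d j →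
              path n d f x j ≡ gapWord (rest x j) (n ∸ j)
  path≡rest zero x j f≡ _ = sym (trans (cong (gapWord (rest x j)) n∸j≡0) (cong a^_ run≡0))
    where
    n∸j≡0 : n ∸ j ≡ 0
    n∸j≡0 = m+n≡0⇒n≡0 (d ∸ x) (sym f≡)
    run≡0 : next Y n d j ∸ x ≡ 0
    run≡0 = trans (cong (_∸ x) (next-≥ Y n d (m∸n≡0⇒m≤n n∸j≡0))) (m+n≡0⇒m≡0 (d ∸ x) (sym f≡))
  path≡rest (suc f) x j f≡ x≤next with (j <? n) ×-dec (suc j * d ≤? n * x)
  ... | yes (j<n , up) = begin
    b ∷ path n d f x (suc j)
      ≡⟨ cong (b ∷_) (path≡rest f x (suc j) f≡′ x≤next′) ⟩
    b ∷ gapWord (rest x (suc j)) (n ∸ suc j)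
      ≡⟨ cong (b ∷_) (gapWord-cong _ shift) ⟩
    b ∷ gapWord (rest x j ∘ suc) (n ∸ suc j)
      ≡⟨ cong (λ r → a^ r ++ b ∷ gapWord (rest x j ∘ suc) (n ∸ suc j)) run≡0 ⟨
    a^ rest x j 0 ++ b ∷ gapWord (rest x j ∘ suc) (n ∸ suc j)
      ≡⟨ cong (gapWord (rest x j)) (∸-suc j<n) ⟨
    gapWord (rest x j) (n ∸ j) ∎
    where
    open ≡-Reasoning
    x≡Y : x ≡ Y (suc j)
    x≡Y = ≤-antisym (≤-trans x≤next (≤-reflexive (next-< Y n d j<n))) (from (Y≤⇔ _ _ j<n) up)
    run≡0 : rest x j 0 ≡ 0
    run≡0 = trans (cong (_∸ x) (next-< Y n d j<n)) (trans (cong (_∸ x) (sym x≡Y)) (n∸n≡0 x))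
    f≡′ : f ≡ (d ∸ x) + (n ∸ suc j)
    f≡′ = suc-injective (trans f≡ (trans (cong (d ∸ x +_) (∸-suc j<n)) (+-suc (d ∸ x) (n ∸ suc j))))
    x≤next′ : x ≤ next Y n d (suc j)
    x≤next′ with suc j <? n
    ... | yes sj<n = ≤-trans (≤-reflexive x≡Y) (Y-mono (n≤1+n (suc j)) sj<n)
    ... | no  _    = ≤-trans (≤-reflexive x≡Y) (Y≤d j<n)
    shift : ∀ i → i ≤ n ∸ suc j → rest x (suc j) i ≡ rest x j (suc i)
    shift zero    _ = cong₂ (λ k y → next Y n d k ∸ y) (+-comm 1 j) (trans x≡Y (cong Y (+-comm 1 j)))
    shift (suc i) _ = cong (gap Y n d) (sym (+-suc j (suc i)))
  ... | no ¬up = trans (cong (a ∷_) (path≡rest f (suc x) j f≡′ x<next))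
                       (sym (gapWord-inc-head (n ∸ j) (∸-suc x<next) (λ _ _ → refl)))
    where
    x<next : x < next Y n d j
    x<next with j <? n
    ... | yes j<n = ≰⇒> (λ Y≤x → ¬up (j<n , to (Y≤⇔ _ _ j<n) Y≤x))
    ... | no  j≮n =
      m∸n≢0⇒n<m (λ d∸x≡0 → 0≢1+n (sym (trans f≡ (cong₂ _+_ d∸x≡0 (m≤n⇒m∸n≡0 (≮⇒≥ j≮n))))))
    f≡′ : f ≡ (d ∸ suc x) + (n ∸ j)
    f≡′ = suc-injective (trans f≡ (cong (_+ (n ∸ j)) (∸-suc (<-≤-trans x<next (next≤d j)))))

c≡pathWord : ∀ n d Y → (∀ j x → j ≤ n → Y j ≤ x ⇔ j * d ≤ n * x) → c n d ≡ pathWord Y n d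
c≡pathWord n d Y Y≤⇔ = trans (path≡rest (d + n) 0 0 refl z≤n) (gapWord-cong n first-run)
  where
  open CeilingPath n d Y Y≤⇔
  first-run : ∀ i → i ≤ n → rest 0 0 i ≡ gap Y n d i
  first-run zero    _ = cong (next Y n d 0 ∸_) (sym Y0≡0)
  first-run (suc i) _ = refl

predHead : (ℕ → ℕ) → ℕ → ℕ
predHead g zero    = g 0 ∸ 1
predHead g (suc i) = g (suc i)

pathWord-a∷-∷ʳb : ∀ N d Y → Y 0 ≡ 0 → 1 ≤ Y 1 → Y (suc N) ≡ d →
                  pathWord Y (suc N) d ≡ a ∷ gapWord (predHead (gap Y (suc N) d)) N ++ [ b ]
pathWord-a∷-∷ʳb N d Y Y0 Y1 Yn = begin
  gapWord g (suc N)                          ≡⟨ gapWord-∷ʳ N g ⟩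
  gapWord g N ++ b ∷ a^ g (suc N)            ≡⟨ cong₂ (λ w r → w ++ b ∷ a^ r) first-a last-empty ⟩
  (a ∷ gapWord (predHead g) N) ++ [ b ]      ∎
  where
  open ≡-Reasoning
  g : ℕ → ℕ
  g = gap Y (suc N) d
  g0≡ : g 0 ≡ Y 1
  g0≡ = trans (gap-< Y (suc N) d (s≤s z≤n)) (cong (Y 1 ∸_) Y0)
  first-a : gapWord g N ≡ a ∷ gapWord (predHead g) N
  first-a = gapWord-inc-head N (sym (m+[n∸m]≡n (subst (1 ≤_) (sym g0≡) Y1))) (λ _ _ → refl)
  last-empty : g (suc N) ≡ 0
  last-empty = trans (gap-≥ Y (suc N) d ≤-refl) (trans (cong (d ∸_) Yn) (n∸n≡0 d))

m-pathWord-reflect : ∀ N d {Y Z} → Y 0 ≡ 0 → Z 0 ≡ 0 → 1 ≤ Y 1 → 1 ≤ Z 1 →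
  Y (suc N) ≡ d → Z (suc N) ≡ d → (∀ i j → 1 ≤ i → 1 ≤ j → i + j ≡ suc N → Y i + Z j ≡ suc d) →
  m (pathWord Y (suc N) d) ≡ m (pathWord Z (suc N) d)
m-pathWord-reflect N d {Y} {Z} Y0 Z0 Y1 Z1 Yn Zn antipodal = begin
  m (pathWord Y (suc N) d)                          ≡⟨ cong m (pathWord-a∷-∷ʳb N d Y Y0 Y1 Yn) ⟩
  m (a ∷ gapWord (predHead gY) N ++ [ b ])          ≡⟨ cong (λ w → m (a ∷ w ++ [ b ])) reflected ⟩
  m (a ∷ reverse (gapWord (predHead gZ) N) ++ [ b ]) ≡⟨ m-a∷reverse-∷ʳb (gapWord (predHead gZ) N) ⟩
  m (a ∷ gapWord (predHead gZ) N ++ [ b ])          ≡⟨ cong m (pathWord-a∷-∷ʳb N d Z Z0 Z1 Zn) ⟨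
  m (pathWord Z (suc N) d)                          ∎
  where
  open ≡-Reasoning
  gY gZ : ℕ → ℕ
  gY = gap Y (suc N) d
  gZ = gap Z (suc N) d
  head-vs-last : ∀ Y Z → Y 0 ≡ 0 → Z (suc N) ≡ d → ∀ j → suc j ≡ suc N →
                 Y 1 + Z j ≡ suc d → predHead (gap Y (suc N) d) 0 ≡ gap Z (suc N) d j
  head-vs-last Y Z Y0 Zn j sj≡n sum = begin
    gap Y (suc N) d 0 ∸ 1 ≡⟨ cong (_∸ 1) (trans (gap-< Y (suc N) d (s≤s z≤n)) (cong (Y 1 ∸_) Y0)) ⟩
    Y 1 ∸ 1              ≡⟨ m+n≡o+p⇒o∸m≡n∸p 1 d (Y 1) (Z j) (sym sum) ⟩
    d ∸ Z j              ≡⟨ cong (_∸ Z j) (trans (cong Z sj≡n) Zn) ⟨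
    Z (suc j) ∸ Z j       ≡⟨ gap-< Z (suc N) d (≤-reflexive sj≡n) ⟨
    gap Z (suc N) d j    ∎
  mirror : ∀ i j → i + j ≡ N → predHead gY i ≡ predHead gZ j
  mirror zero zero refl = cong (_∸ 1) (trans (gap-< Y (suc N) d (s≤s z≤n))
    (trans (cong₂ _∸_ (trans Yn (sym Zn)) (trans Y0 (sym Z0))) (sym (gap-< Z (suc N) d (s≤s z≤n)))))
  mirror zero (suc j) refl = head-vs-last Y Z Y0 Zn (suc j) refl (antipodal 1 (suc j) ≤-refl (s≤s z≤n) refl)
  mirror (suc i) zero i+0≡N =
    sym (head-vs-last Z Y Z0 Yn (suc i) ssi≡n
           (trans (+-comm (Z 1) _) (antipodal (suc i) 1 (s≤s z≤n) ≤-refl si+1≡n)))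
    where
    ssi≡n : suc (suc i) ≡ suc N
    ssi≡n = cong suc (trans (sym (+-identityʳ (suc i))) i+0≡N)
    si+1≡n : suc i + 1 ≡ suc N
    si+1≡n = trans (+-comm (suc i) 1) ssi≡n
  mirror (suc i) (suc j) i+j≡N = begin
    gY (suc i)
      ≡⟨ gap-< Y (suc N) d (s≤s (m+n≤o⇒m≤o (suc i) (≤-reflexive i+j≡N))) ⟩
    Y (2 + i) ∸ Y (suc i)
      ≡⟨ m+n≡o+p⇒o∸m≡n∸p (Y (suc i)) (Z (2 + j)) (Y (2 + i)) (Z (suc j)) (trans inner (sym outer)) ⟩
    Z (2 + j) ∸ Z (suc j)
      ≡⟨ gap-< Z (suc N) d (s≤s (m+n≤o⇒n≤o (suc i) (≤-reflexive i+j≡N))) ⟨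
    gZ (suc j) ∎
    where
    inner : Y (suc i) + Z (2 + j) ≡ suc d
    inner = antipodal (suc i) (2 + j) (s≤s z≤n) (s≤s z≤n) (trans (+-suc (suc i) (suc j)) (cong suc i+j≡N))
    outer : Y (2 + i) + Z (suc j) ≡ suc d
    outer = antipodal (2 + i) (suc j) (s≤s z≤n) (s≤s z≤n) (cong suc i+j≡N)
  reflected : gapWord (predHead gY) N ≡ reverse (gapWord (predHead gZ) N)
  reflected = trans (gapWord-cong N (λ i i≤N → mirror i (N ∸ i) (m+[n∸m]≡n i≤N)))
                    (sym (gapWord-reverse N (predHead gZ)))

gap≡0 : ∀ W n D i → W i ≡ D → (i < n → W (suc i) ≡ D) → gap W n D i ≡ 0
gap≡0 W n D i Wi≡D flat = trans (cong₂ _∸_ (next-flat) Wi≡D) (n∸n≡0 D)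
  where
  next-flat : next W n D i ≡ D
  next-flat with i <? n
  ... | yes i<n = flat i<n
  ... | no  _   = refl

m-pathWord-clip : ∀ n d Z → Z 0 ≡ 0 → (∀ {i j} → i ≤ j → j ≤ n → Z i ≤ Z j) → Z n ≡ suc d →
                  m (pathWord (λ j → Z j ⊓ d) n d) < m (pathWord Z n (suc d))
m-pathWord-clip n d Z Z0 Z-mono Zn
  with crossing Z d n (subst (_≤ d) (sym Z0) z≤n) (subst (d <_) (sym Zn) ≤-refl)
... | j₀ , j₀<n , Zj₀≤d , d<Z = m-gapWord-insert n j₀ (<⇒≤ j₀<n) grows same
  where
  Y : ℕ → ℕ
  Y j = Z j ⊓ d
  top : ∀ i → j₀ < i → i ≤ n → Z i ≡ suc d
  top i j₀<i i≤n =
    ≤-antisym (≤-trans (Z-mono i≤n ≤-refl) (≤-reflexive Zn)) (<-≤-trans d<Z (Z-mono j₀<i i≤n))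
  below : ∀ i → i ≤ j₀ → Y i ≡ Z i
  below i i≤j₀ = m≤n⇒m⊓n≡m (≤-trans (Z-mono i≤j₀ (<⇒≤ j₀<n)) Zj₀≤d)
  above : ∀ i → j₀ < i → i ≤ n → Y i ≡ d
  above i j₀<i i≤n = m≥n⇒m⊓n≡n (≤-trans (n≤1+n d) (≤-reflexive (sym (top i j₀<i i≤n))))
  grows : gap Z n (suc d) j₀ ≡ suc (gap Y n d j₀)
  grows = begin
    gap Z n (suc d) j₀        ≡⟨ gap-< Z n (suc d) j₀<n ⟩
    Z (suc j₀) ∸ Z j₀         ≡⟨ cong (_∸ Z j₀) (top (suc j₀) ≤-refl j₀<n) ⟩
    suc d ∸ Z j₀              ≡⟨ +-∸-assoc 1 Zj₀≤d ⟩
    suc (d ∸ Z j₀)            ≡⟨ cong suc (cong₂ _∸_ (above (suc j₀) ≤-refl j₀<n) (below j₀ ≤-refl)) ⟨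
    suc (Y (suc j₀) ∸ Y j₀)   ≡⟨ cong suc (gap-< Y n d j₀<n) ⟨
    suc (gap Y n d j₀)        ∎
    where open ≡-Reasoning
  same : ∀ i → i ≤ n → i ≢ j₀ → gap Z n (suc d) i ≡ gap Y n d i
  same i i≤n i≢j₀ with <-cmp i j₀
  ... | tri< i<j₀ _ _ = trans (gap-< Z n (suc d) i<n)
    (sym (trans (gap-< Y n d i<n) (cong₂ _∸_ (below (suc i) i<j₀) (below i (<⇒≤ i<j₀)))))
    where i<n = <-trans i<j₀ j₀<n
  ... | tri≈ _ i≡j₀ _ = ⊥-elim (i≢j₀ i≡j₀)
  ... | tri> _ _ j₀<i =
    trans (gap≡0 Z n (suc d) i (top i j₀<i i≤n) (λ i<n → top (suc i) (m<n⇒m<1+n j₀<i) i<n))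
          (sym (gap≡0 Y n d i (above i j₀<i i≤n) (λ i<n → above (suc i) (m<n⇒m<1+n j₀<i) i<n)))

m-pathWord-raise : ∀ {n d} K v {Y Y′} → K + suc (suc v) ≡ n →
  Y K ≤ Y (suc K) → Y′ (suc K) ≡ suc (Y (suc K)) → Y′ (suc K) ≤ Y (2 + K) →
  (∀ j → j ≢ suc K → Y′ j ≡ Y j) →
  LeftDominant (gap Y n d) K (λ i → gap Y′ n d (suc K + i)) v →
  m (pathWord Y n d) ≤ m (pathWord Y′ n d)
m-pathWord-raise {n} {d} K v {Y} {Y′} refl YK≤Yk Y′k≡ Y′k≤ unchanged dominant =
  m-gapWord-swap K (suc v) left-grows right-shrinks same (swappable-leftDominant K _ v _ dominant)
  where
  K<n : K < n
  K<n = m<m+n K (s≤s z≤n)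
  k<n : suc K < n
  k<n = subst (_< n) (+-comm K 1) (+-monoʳ-< K (s≤s (s≤s z≤n)))
  left-grows : gap Y′ n d K ≡ suc (gap Y n d K)
  left-grows = begin
    gap Y′ n d K                ≡⟨ gap-< Y′ n d K<n ⟩
    Y′ (suc K) ∸ Y′ K           ≡⟨ cong₂ _∸_ Y′k≡ (unchanged K (1+n≢n ∘ sym)) ⟩
    suc (Y (suc K)) ∸ Y K       ≡⟨ +-∸-assoc 1 YK≤Yk ⟩
    suc (Y (suc K) ∸ Y K)       ≡⟨ cong suc (gap-< Y n d K<n) ⟨
    suc (gap Y n d K)           ∎
    where open ≡-Reasoning
  right-shrinks : gap Y n d (suc K) ≡ suc (gap Y′ n d (suc K))
  right-shrinks = begin
    gap Y n d (suc K)                ≡⟨ gap-< Y n d k<n ⟩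
    Y (2 + K) ∸ Y (suc K)             ≡⟨ ∸-suc (subst (_≤ Y (2 + K)) Y′k≡ Y′k≤) ⟩
    suc (Y (2 + K) ∸ suc (Y (suc K))) ≡⟨ cong suc (cong₂ _∸_ (unchanged (2 + K) 1+n≢n) Y′k≡) ⟨
    suc (Y′ (2 + K) ∸ Y′ (suc K))     ≡⟨ cong suc (gap-< Y′ n d k<n) ⟨
    suc (gap Y′ n d (suc K))         ∎
    where open ≡-Reasoning
  same : ∀ i → i ≢ K → i ≢ suc K → gap Y′ n d i ≡ gap Y n d i
  same i i≢K i≢k =
    cong₂ _∸_ (next-cong n d i (λ _ → unchanged (suc i) (i≢K ∘ suc-injective))) (unchanged i i≢k)

-- The lattice path hugging the line through the origin and (x , k) (abscissa x at height k):
-- strictly to its right below height k, weakly to its right above, and cut off at abscissa d.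
module LinePath {n d K x : ℕ} {Y : ℕ → ℕ}
  (k<n : suc K < n) (x<d : x < d) (steep : suc K * d < n * x)
  (Y0 : Y 0 ≡ 0) (Yk : Y (suc K) ≡ x)
  (Y-below : ∀ {j} y → 1 ≤ j → j < suc K → Y j ≤ y ⇔ j * x < suc K * y)
  (Y≤d : ∀ {j} → suc K < j → j ≤ n → Y j ≤ d)
  (Y-above : ∀ {j} y → suc K < j → j ≤ n → y < d → Y j ≤ y ⇔ j * x ≤ suc K * y)
  where

  k : ℕ
  k = suc K

  1≤x : 1 ≤ x
  1≤x = ≰⇒> (λ x≤0 → n≮0 (<-≤-trans steep (≤-trans (*-monoʳ-≤ n x≤0) (≤-reflexive (*-zeroʳ n)))))

  x<Y[1+k] : x < Y (suc k)
  x<Y[1+k] = ≰⇒> (λ Y≤x →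
    <-irrefl refl (<-≤-trans (m<n+m (k * x) 1≤x) (to (Y-above x ≤-refl k<n x<d) Y≤x)))

  Y-step : ∀ {j} → j < n → Y j ≤ Y (suc j)
  Y-step {zero}  _     = subst (_≤ Y 1) (sym Y0) z≤n
  Y-step {suc i} si<n with <-cmp (suc i) k
  ... | tri< si<k _ _ with m≤n⇒m<n∨m≡n si<k
  ...   | inj₁ ssi<k =
    from (Y-below _ (s≤s z≤n) (<-trans (n<1+n _) ssi<k))
         (≤-<-trans (*-monoˡ-≤ x (n≤1+n (suc i))) (to (Y-below _ (s≤s z≤n) ssi<k) ≤-refl))
  ...   | inj₂ ssi≡k = ≤-trans (from (Y-below x (s≤s z≤n) si<k) (*-monoˡ-< x {{>-nonZero 1≤x}} si<k))
                               (≤-reflexive (trans (sym Yk) (cong Y (sym ssi≡k))))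
  Y-step {suc i} si<n | tri≈ _ si≡k _ =
    subst (λ j → Y j ≤ Y (suc j)) (sym si≡k) (≤-trans (≤-reflexive Yk) (<⇒≤ x<Y[1+k]))
  Y-step {suc i} si<n | tri> _ _ k<si with Y (2 + i) <? d
  ... | yes Y<d =
    from (Y-above _ k<si (<⇒≤ si<n) Y<d)
         (≤-trans (*-monoˡ-≤ x (n≤1+n (suc i))) (to (Y-above _ (<-trans k<si (n<1+n _)) si<n Y<d) ≤-refl))
  ... | no  Y≮d = ≤-trans (Y≤d k<si (<⇒≤ si<n)) (≮⇒≥ Y≮d)

  below-floor : ∀ {j} → 1 ≤ j → j < k → ∃[ p ] (Y j ≡ suc p × k * p ≤ j * x × j * x < k * suc p)
  below-floor 1≤j j<k = floor-of {k = k} (λ y → Y-below y 1≤j j<k)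

  above-ceil : ∀ {j} → k < j → j ≤ n →
    (∃[ q ] (Y j ≡ suc q × k * q < j * x × j * x ≤ k * suc q)) ⊎ (Y j ≡ d × k * d < j * x)
  above-ceil {j} k<j j≤n with j * x ≤? k * d
  ... | no  jx≰kd = inj₂ (≤-antisym (Y≤d k<j j≤n) (≮⇒≥ Y≮d) , ≰⇒> jx≰kd)
    where
    Y≮d : Y j ≮ d
    Y≮d Y<d = jx≰kd (≤-trans (to (Y-above (Y j) k<j j≤n Y<d) ≤-refl) (*-monoʳ-≤ k (<⇒≤ Y<d)))
  ... | yes jx≤kd = inj₁ (ceil-of {k = k} (*-mono-≤ (≤-trans (s≤s z≤n) (<⇒≤ k<j)) 1≤x) Y≤⇔)
    where
    Y≤⇔ : ∀ y → Y j ≤ y ⇔ j * x ≤ k * y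
    Y≤⇔ y with y <? d
    ... | yes y<d = Y-above y k<j j≤n y<d
    ... | no  y≮d = mk⇔ (λ _ → ≤-trans jx≤kd (*-monoʳ-≤ k (≮⇒≥ y≮d))) (λ _ → ≤-trans (Y≤d k<j j≤n) (≮⇒≥ y≮d))

  lo*x+hi*x≡k*[x+x] : ∀ {lo hi} → lo + hi ≡ k + k → lo * x + hi * x ≡ k * (x + x)
  lo*x+hi*x≡k*[x+x] {lo} {hi} sum =
    trans (sym (*-distribʳ-+ x lo hi)) (trans (cong (_* x) sum) (double k x))
    where
    double : ∀ k x → (k + k) * x ≡ k * (x + x)
    double = solve-∀

  -- Around height k the path is point-symmetric (abscissae summing to 2x+1) until, going
  -- outward, it first meets the origin or the cut at d, where the left side runs longer.
  balance : ∀ {lo hi} → lo < k → k < hi → hi ≤ n → lo + hi ≡ k + k →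
            (1 ≤ lo × hi < n × Y lo + Y hi ≡ suc (x + x)) ⊎ Y lo + Y hi ≤ x + x
  balance {zero} {hi} _ k<hi hi≤n hi≡2k = inj₂ (subst (_≤ x + x) (cong (_+ Y hi) (sym Y0)) Yhi≤2x)
    where
    Yhi≤2x : Y hi ≤ x + x
    Yhi≤2x with x + x <? d
    ... | yes 2x<d = from (Y-above (x + x) k<hi hi≤n 2x<d) (≤-reflexive (lo*x+hi*x≡k*[x+x] {0} hi≡2k))
    ... | no  2x≮d = ≤-trans (Y≤d k<hi hi≤n) (≮⇒≥ 2x≮d)
  balance {suc lo} {hi} lo<k k<hi hi≤n sum with below-floor (s≤s z≤n) lo<k | above-ceil k<hi hi≤n
  ... | p , Ylo≡ , kp≤ , <kp′ | inj₁ (q , Yhi≡ , kq< , ≤kq′) = inj₁ (s≤s z≤n , hi<n , Y-sum)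
    where
    Y-sum : Y (suc lo) + Y hi ≡ suc (x + x)
    Y-sum = trans (cong₂ _+_ Ylo≡ Yhi≡)
                  (floor+ceil {k = k} kp≤ <kp′ kq< ≤kq′ (lo*x+hi*x≡k*[x+x] {suc lo} sum))
    hi≢n : hi ≢ n
    hi≢n refl =
      <-irrefl refl (<-≤-trans steep (≤-trans ≤kq′ (*-monoʳ-≤ k (subst (_≤ d) Yhi≡ (Y≤d k<hi hi≤n)))))
    hi<n : hi < n
    hi<n = ≤∧≢⇒< hi≤n hi≢n
  ... | p , Ylo≡ , kp≤ , _ | inj₂ (Yhi≡d , kd<) =
    inj₂ (subst (_≤ x + x) (sym (cong₂ _+_ Ylo≡ Yhi≡d)) (*-cancelˡ-< k _ _ (begin-strict
      k * (p + d)            ≡⟨ *-distribˡ-+ k p d ⟩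
      k * p + k * d          <⟨ +-mono-≤-< kp≤ kd< ⟩
      suc lo * x + hi * x    ≡⟨ lo*x+hi*x≡k*[x+x] {suc lo} sum ⟩
      k * (x + x)            ∎)))
    where open ≤-Reasoning

  module Raising {Y′ : ℕ → ℕ} (Y′k : Y′ k ≡ suc x) (unchanged : ∀ j → j ≢ k → Y′ j ≡ Y j) where

    Y′-step : ∀ {j} → k ≤ j → j < n → Y′ j ≤ Y (suc j)
    Y′-step {j} k≤j j<n with m≤n⇒m<n∨m≡n k≤j
    ... | inj₁ k<j  = ≤-trans (≤-reflexive (unchanged j (λ { refl → <-irrefl refl k<j }))) (Y-step j<n)
    ... | inj₂ refl = ≤-trans (≤-reflexive Y′k) x<Y[1+k]

    lo<k : ∀ lo hi → suc lo + hi ≡ k + k → k ≤ hi → lo < k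
    lo<k lo hi sum k≤hi = +-cancelʳ-< hi lo k (≤-trans (≤-reflexive sum) (+-monoʳ-≤ k k≤hi))

    lo<n : ∀ lo hi → suc lo + hi ≡ k + k → k ≤ hi → lo < n
    lo<n lo hi sum k≤hi = <-trans (lo<k lo hi sum k≤hi) k<n

    1+hi≤n : ∀ hi v → hi + suc v ≡ n → suc hi ≤ n
    1+hi≤n hi v hi+v≡n = subst (suc hi ≤_) (trans (sym (+-suc hi v)) hi+v≡n) (s≤s (m≤m+n hi v))

    first-run : ∀ hi v → hi + suc v ≡ n → k ≤ hi → (r : ℕ → ℕ) → (∀ i → r i ≡ gap Y′ n d (hi + i)) →
                r 0 ≡ Y (suc hi) ∸ Y′ hi
    first-run hi v hi+v≡n k≤hi r r≡ = begin
      r 0                  ≡⟨ trans (r≡ 0) (cong (gap Y′ n d) (+-identityʳ hi)) ⟩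
      gap Y′ n d hi        ≡⟨ gap-< Y′ n d (1+hi≤n hi v hi+v≡n) ⟩
      Y′ (suc hi) ∸ Y′ hi  ≡⟨ cong (_∸ Y′ hi) (unchanged (suc hi) (<⇒≢ (s≤s k≤hi) ∘ sym)) ⟩
      Y (suc hi) ∸ Y′ hi   ∎
      where open ≡-Reasoning

    -- Compares the runs on either side of the flipped square, going outward from it.
    dominant : ∀ lo hi v → suc lo + hi ≡ k + k → hi + suc v ≡ n → k ≤ hi →
      Y (suc lo) + Y′ hi ≡ suc (x + x) → (r : ℕ → ℕ) → (∀ i → r i ≡ gap Y′ n d (hi + i)) →
      LeftDominant (gap Y n d) lo r v
    dominant lo hi v sum hi+v≡n k≤hi centre r r≡
      with balance (lo<k lo hi sum k≤hi) (s≤s k≤hi) (1+hi≤n hi v hi+v≡n) (trans (+-suc lo hi) sum)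
    dominant lo hi v sum hi+v≡n k≤hi centre r r≡ | inj₂ heavy = leftDominant-< lo v (begin-strict
      r 0                 ≡⟨ first-run hi v hi+v≡n k≤hi r r≡ ⟩
      Y (suc hi) ∸ Y′ hi  <⟨ p+o<m+n⇒p∸n<m∸o (Y-step lo<n′) (Y′-step k≤hi (1+hi≤n hi v hi+v≡n)) off-centre ⟩
      Y (suc lo) ∸ Y lo   ≡⟨ gap-< Y n d lo<n′ ⟨
      gap Y n d lo        ∎)
      where
      open ≤-Reasoning
      lo<n′ : lo < n
      lo<n′ = lo<n lo hi sum k≤hi
      off-centre : Y (suc hi) + Y lo < Y (suc lo) + Y′ hi
      off-centre = begin-strict
        Y (suc hi) + Y lo   ≡⟨ +-comm (Y (suc hi)) (Y lo) ⟩
        Y lo + Y (suc hi)   <⟨ s≤s heavy ⟩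
        suc (x + x)         ≡⟨ centre ⟨
        Y (suc lo) + Y′ hi  ∎
    dominant (suc lo) hi (suc v) sum hi+v≡n k≤hi centre r r≡ | inj₁ (_ , _ , symmetric) =
      inj₂ (same-run , dominant lo (suc hi) v sum′ hi+v≡n′ (m≤n⇒m≤1+n k≤hi) centre′ (r ∘ suc) r≡′)
      where
      open ≡-Reasoning
      opposite : Y′ hi + Y (2 + lo) ≡ Y (suc hi) + Y (suc lo)
      opposite = trans (+-comm (Y′ hi) _) (trans centre (sym (trans (+-comm (Y (suc hi)) _) symmetric)))
      same-run : r 0 ≡ gap Y n d (suc lo)
      same-run = begin
        r 0                      ≡⟨ first-run hi (suc v) hi+v≡n k≤hi r r≡ ⟩
        Y (suc hi) ∸ Y′ hi       ≡⟨ m+n≡o+p⇒o∸m≡n∸p (Y′ hi) (Y (2 + lo)) (Y (suc hi)) (Y (suc lo)) opposite ⟩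
        Y (2 + lo) ∸ Y (suc lo)  ≡⟨ gap-< Y n d (lo<n (suc lo) hi sum k≤hi) ⟨
        gap Y n d (suc lo)       ∎
      sum′ : suc lo + suc hi ≡ k + k
      sum′ = trans (+-suc (suc lo) hi) sum
      hi+v≡n′ : suc hi + suc v ≡ n
      hi+v≡n′ = trans (sym (+-suc hi (suc v))) hi+v≡n
      centre′ : Y (suc lo) + Y′ (suc hi) ≡ suc (x + x)
      centre′ = trans (cong (Y (suc lo) +_) (unchanged (suc hi) (<⇒≢ (s≤s k≤hi) ∘ sym))) symmetric
      r≡′ : ∀ i → r (suc i) ≡ gap Y′ n d (suc hi + i)
      r≡′ i = trans (r≡ (suc i)) (cong (gap Y′ n d) (+-suc hi i))
    dominant (suc lo) hi zero sum hi+v≡n k≤hi centre r r≡ | inj₁ (_ , 1+hi<n , _) =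
      ⊥-elim (<-irrefl (trans (+-comm 1 hi) hi+v≡n) 1+hi<n)

    m-raise : m (pathWord Y n d) ≤ m (pathWord Y′ n d)
    m-raise = m-pathWord-raise K v n≡ (Y-step (<-trans (n<1+n K) k<n)) (trans Y′k (cong suc (sym Yk)))
                (≤-trans (≤-reflexive Y′k) x<Y[1+k]) unchanged
                (dominant K k v refl k+v≡n ≤-refl centre (λ i → gap Y′ n d (k + i)) (λ _ → refl))
      where
      v : ℕ
      v = n ∸ suc k
      k+v≡n : k + suc v ≡ n
      k+v≡n = trans (+-suc k v) (m+[n∸m]≡n k<n)
      n≡ : K + suc (suc v) ≡ n
      n≡ = trans (+-suc K (suc v)) k+v≡n
      centre : Y k + Y′ k ≡ suc (x + x)
      centre = trans (cong₂ _+_ Yk Y′k) (+-suc x x)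
-- The Christoffel paths c(n,d)

module Slopes (n′ d′ : ℕ) where

  n d : ℕ
  n = suc n′
  d = suc d′

  -- the abscissa of the j-th up step of c(n,d)
  xc : ℕ → ℕ
  xc j = ⌈ j * d /suc n′ ⌉

  xc≤⇔ : ∀ j y → xc j ≤ y ⇔ j * d ≤ n * y
  xc≤⇔ j y = ⌈/suc⌉≤⇔ (j * d) n′ y

  xc-bound : ∀ j → j * d ≤ n * xc j
  xc-bound j = to (xc≤⇔ j (xc j)) ≤-refl

  xc-0 : xc 0 ≡ 0
  xc-0 = n≤0⇒n≡0 (from (xc≤⇔ 0 0) z≤n)

  xc-n : xc n ≡ d
  xc-n = ≤-antisym (from (xc≤⇔ n d) ≤-refl)
                   (≰⇒> (λ xcn≤d′ → 1+n≰n (*-cancelˡ-≤ n (to (xc≤⇔ n d′) xcn≤d′))))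

  xc-pos : ∀ {j} → 1 ≤ j → 1 ≤ xc j
  xc-pos {j} 1≤j = ≰⇒> (λ xcj≤0 → n≮0 (begin-strict
    0          <⟨ *-mono-≤ 1≤j (s≤s (z≤n {d′})) ⟩
    j * d      ≤⟨ to (xc≤⇔ j 0) xcj≤0 ⟩
    n * 0      ≡⟨ *-zeroʳ n ⟩
    0          ∎))
    where open ≤-Reasoning

  xc-mono : ∀ {i j} → i ≤ j → xc i ≤ xc j
  xc-mono {i} {j} i≤j = from (xc≤⇔ i (xc j)) (≤-trans (*-monoˡ-≤ d i≤j) (xc-bound j))

  xc≤d : ∀ {j} → j ≤ n → xc j ≤ d
  xc≤d {j} j≤n = from (xc≤⇔ j d) (*-monoˡ-≤ d j≤n)

  -- the j-th up step can move one unit right, staying weakly below the segment to (d + 1 , n)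
  Raisable : ℕ → Set
  Raisable j = xc j < d × n * xc j < j * suc d

  raisable? : ∀ j → Dec (Raisable j)
  raisable? j = (xc j <? d) ×-dec (n * xc j <? j * suc d)

  raisable-pos : ∀ {j} → Raisable j → 1 ≤ j
  raisable-pos {zero}  (_ , ())
  raisable-pos {suc j} _ = s≤s z≤n

  -- j comes before the cut at K: the slope xc j / j is below xc K / K, or equal with j < T
  Before : ℕ → ℕ → ℕ → Set
  Before K T j = K * xc j < j * xc K ⊎ (j * xc K ≡ K * xc j × j < T)

  before? : ∀ K T j → Dec (Before K T j)
  before? K T j = (K * xc j <? j * xc K) ⊎-dec ((j * xc K ≟ K * xc j) ×-dec (j <? T))

  _≺_ : ℕ → ℕ → Set
  j ≺ k = Before k k j

  ≺-irrefl : ∀ {j} → ¬ j ≺ j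
  ≺-irrefl (inj₁ lt)       = <-irrefl refl lt
  ≺-irrefl (inj₂ (_ , lt)) = <-irrefl refl lt

  ≺-trichotomy : ∀ i j → i ≺ j ⊎ i ≡ j ⊎ j ≺ i
  ≺-trichotomy i j with <-cmp (j * xc i) (i * xc j)
  ... | tri< lt _ _ = inj₁ (inj₁ lt)
  ... | tri> _ _ gt = inj₂ (inj₂ (inj₁ gt))
  ... | tri≈ _ eq _ with <-cmp i j
  ...   | tri< i<j _ _ = inj₁ (inj₂ (sym eq , i<j))
  ...   | tri≈ _ i≡j _ = inj₂ (inj₁ i≡j)
  ...   | tri> _ _ j<i = inj₂ (inj₂ (inj₂ (eq , j<i)))

  before-trans : ∀ {K T i j} → 1 ≤ K → 1 ≤ i → 1 ≤ j → i ≺ j → Before K T j → Before K T i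
  before-trans {K} {T} {i} {j} 1≤K 1≤i 1≤j i≺j j-before with i≺j | j-before
  ... | inj₁ lt       | inj₁ lt′       = inj₁ (cross-<≤ (xc i) (xc j) (xc K) i j K 1≤K lt (<⇒≤ lt′))
  ... | inj₁ lt       | inj₂ (eq′ , _) = inj₁ (cross-<≤ (xc i) (xc j) (xc K) i j K 1≤K lt (≤-reflexive (sym eq′)))
  ... | inj₂ (eq , _) | inj₁ lt′       = inj₁ (cross-≤< (xc i) (xc j) (xc K) i j K 1≤i (≤-reflexive (sym eq)) lt′)
  ... | inj₂ (eq , i<j) | inj₂ (eq′ , j<T) =
    inj₂ (sym (cross-≡ (xc i) (xc j) (xc K) i j K 1≤j (sym eq) (sym eq′)) , <-trans i<j j<T)

  Raised : ℕ → ℕ → ℕ → Set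
  Raised K T j = Raisable j × Before K T j

  raised? : ∀ K T j → Dec (Raised K T j)
  raised? K T j = raisable? j ×-dec before? K T j

  -- c(n,d) with the raisable up steps before the cut (K , T) moved one unit right
  Ycut : ℕ → ℕ → ℕ → ℕ
  Ycut K T j = xc j + 𝟙 (raised? K T j)

  Ycut-raised : ∀ K T j → Raised K T j → Ycut K T j ≡ suc (xc j)
  Ycut-raised K T j r = trans (cong (xc j +_) (𝟙-yes (raised? K T j) r)) (+-comm (xc j) 1)

  Ycut-unraised : ∀ K T j → ¬ Raised K T j → Ycut K T j ≡ xc j
  Ycut-unraised K T j ¬r = trans (cong (xc j +_) (𝟙-no (raised? K T j) ¬r)) (+-identityʳ (xc j))

  Ycut≤d : ∀ K T {j} → j ≤ n → Ycut K T j ≤ d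
  Ycut≤d K T {j} j≤n with raised? K T j
  ... | yes ((xcj<d , _) , _) = subst (_≤ d) (+-comm 1 (xc j)) xcj<d
  ... | no  _           = subst (_≤ d) (sym (+-identityʳ (xc j))) (xc≤d j≤n)

  -- Ycut k k is the path hugging the line through the origin and (xc k , k), as in LinePath.
  module Pivot {k : ℕ} (1≤k : 1 ≤ k) (k≤n : k ≤ n) (moves : n * xc k < k * suc d) where

    x : ℕ
    x = xc k

    Y : ℕ → ℕ
    Y = Ycut k k

    left-of-line : ∀ j y → n * y < j * d → k * y < j * x
    left-of-line j y ny<jd = *-cancelˡ-< n _ _ (begin-strict
      n * (k * y) ≡⟨ x∙yz≈y∙xz n k y ⟩
      k * (n * y) <⟨ *-monoʳ-< k {{>-nonZero 1≤k}} ny<jd ⟩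
      k * (j * d) ≡⟨ x∙yz≈y∙xz k j d ⟩
      j * (k * d) ≤⟨ *-monoʳ-≤ j (xc-bound k) ⟩
      j * (n * x) ≡⟨ x∙yz≈y∙xz j n x ⟩
      n * (j * x) ∎)
      where open ≤-Reasoning

    right-of-line : ∀ {j} → 1 ≤ j → j ≤ n → j * x < k * suc (xc j)
    right-of-line {j} 1≤j j≤n = *-cancelˡ-< n _ _ (begin-strict
      n * (j * x)          ≡⟨ x∙yz≈y∙xz n j x ⟩
      j * (n * x)          <⟨ *-monoʳ-< j {{>-nonZero 1≤j}} moves ⟩
      j * (k * suc d)      ≡⟨ x∙yz≈y∙xz j k (suc d) ⟩
      k * (j * suc d)      ≡⟨ cong (k *_) (*-suc j d) ⟩
      k * (j + j * d)      ≤⟨ *-monoʳ-≤ k (+-mono-≤ j≤n (xc-bound j)) ⟩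
      k * (n + n * xc j)   ≡⟨ cong (k *_) (*-suc n (xc j)) ⟨
      k * (n * suc (xc j)) ≡⟨ x∙yz≈y∙xz k n (suc (xc j)) ⟩
      n * (k * suc (xc j)) ∎)
      where open ≤-Reasoning

    moves-if-flatter : ∀ {j} → 1 ≤ j → k * xc j ≤ j * x → n * xc j < j * suc d
    moves-if-flatter {j} 1≤j flatter = *-cancelˡ-< k _ _ (begin-strict
      k * (n * xc j)  ≡⟨ x∙yz≈y∙xz k n (xc j) ⟩
      n * (k * xc j)  ≤⟨ *-monoʳ-≤ n flatter ⟩
      n * (j * x)     ≡⟨ x∙yz≈y∙xz n j x ⟩
      j * (n * x)     <⟨ *-monoʳ-< j {{>-nonZero 1≤j}} moves ⟩
      j * (k * suc d) ≡⟨ x∙yz≈y∙xz j k (suc d) ⟩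
      k * (j * suc d) ∎)
      where open ≤-Reasoning

    Y-below : ∀ {j} y → 1 ≤ j → j < k → Y j ≤ y ⇔ j * x < k * y
    Y-below {j} y 1≤j j<k with raised? k k j
    ... | yes (_ , before) = mk⇔
      (λ xcj+1≤y → <-≤-trans (right-of-line 1≤j j≤n) (*-monoʳ-≤ k (subst (_≤ y) (+-comm (xc j) 1) xcj+1≤y)))
      (λ jx<ky → subst (_≤ y) (+-comm 1 (xc j)) (*-cancelˡ-< k _ _ (≤-<-trans flatter jx<ky)))
      where
      j≤n : j ≤ n
      j≤n = ≤-trans (<⇒≤ j<k) k≤n
      flatter : k * xc j ≤ j * x
      flatter = [ <⇒≤ , (λ (eq , _) → ≤-reflexive (sym eq)) ]′ before
    ... | no ¬raised = mk⇔
      (λ xcj≤y → <-≤-trans steeper (*-monoʳ-≤ k (subst (_≤ y) (+-identityʳ (xc j)) xcj≤y)))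
      (λ jx<ky → subst (_≤ y) (sym (+-identityʳ (xc j)))
                   (from (xc≤⇔ j y) (≮⇒≥ (λ ny<jd → <-asym jx<ky (left-of-line j y ny<jd)))))
      where
      raisable : k * xc j ≤ j * x → Raisable j
      raisable flatter =
        <-≤-trans (*-cancelˡ-< k _ _ (≤-<-trans flatter (*-monoˡ-< x {{>-nonZero (xc-pos 1≤k)}} j<k))) (xc≤d k≤n) ,
        moves-if-flatter 1≤j flatter
      steeper : j * x < k * xc j
      steeper with <-cmp (j * x) (k * xc j)
      ... | tri< lt _ _ = lt
      ... | tri≈ _ eq _ = ⊥-elim (¬raised (raisable (≤-reflexive (sym eq)) , inj₂ (eq , j<k)))
      ... | tri> _ _ gt = ⊥-elim (¬raised (raisable (<⇒≤ gt) , inj₁ gt))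

    Y-above : ∀ {j} y → k < j → j ≤ n → y < d → Y j ≤ y ⇔ j * x ≤ k * y
    Y-above {j} y k<j j≤n y<d with raised? k k j
    ... | yes (_ , inj₂ (_ , j<k)) = ⊥-elim (<-asym k<j j<k)
    ... | yes (_ , inj₁ flatter) = mk⇔
      (λ xcj+1≤y → <⇒≤ (<-≤-trans (right-of-line 1≤j j≤n) (*-monoʳ-≤ k (subst (_≤ y) (+-comm (xc j) 1) xcj+1≤y))))
      (λ jx≤ky → subst (_≤ y) (+-comm 1 (xc j)) (*-cancelˡ-< k _ _ (<-≤-trans flatter jx≤ky)))
      where
      1≤j : 1 ≤ j
      1≤j = ≤-trans 1≤k (<⇒≤ k<j)
    ... | no ¬raised with j * x ≤? k * xc j
    ...   | yes steeper = mk⇔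
      (λ xcj≤y → ≤-trans steeper (*-monoʳ-≤ k (subst (_≤ y) (+-identityʳ (xc j)) xcj≤y)))
      (λ jx≤ky → subst (_≤ y) (sym (+-identityʳ (xc j)))
                   (from (xc≤⇔ j y) (≮⇒≥ (λ ny<jd → <-irrefl refl (<-≤-trans (left-of-line j y ny<jd) jx≤ky)))))
    ...   | no  jx≰kxcj = mk⇔
      (λ xcj≤y → ⊥-elim (d≰y (≤-trans d≤xcj (subst (_≤ y) (+-identityʳ (xc j)) xcj≤y))))
      (λ jx≤ky → ⊥-elim (d≰y (≤-trans d≤xcj (<⇒≤ (*-cancelˡ-< k _ _ (<-≤-trans flatter jx≤ky))))))
      where
      1≤j : 1 ≤ j
      1≤j = ≤-trans 1≤k (<⇒≤ k<j)
      flatter : k * xc j < j * x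
      flatter = ≰⇒> jx≰kxcj
      d≤xcj : d ≤ xc j
      d≤xcj = ≮⇒≥ (λ xcj<d → ¬raised ((xcj<d , moves-if-flatter 1≤j (<⇒≤ flatter)) , inj₁ flatter))
      d≰y : d ≰ y
      d≰y = <⇒≱ y<d

  before-widen : ∀ {K T j} → Before K T j → Before K (suc T) j
  before-widen (inj₁ lt)        = inj₁ lt
  before-widen (inj₂ (eq , j<T)) = inj₂ (eq , m<n⇒m<1+n j<T)

  m-raise-at : ∀ K → suc K < n → Raisable (suc K) → suc K * d < n * xc (suc K) →
               m (pathWord (Ycut (suc K) (suc K)) n d) ≤ m (pathWord (Ycut (suc K) (2 + K)) n d)
  m-raise-at K k<n r steep = Raising.m-raise Y′k unchanged
    where
    k : ℕ
    k = suc K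
    open Pivot (s≤s z≤n) (<⇒≤ k<n) (proj₂ r)
    Y0 : Y 0 ≡ 0
    Y0 = trans (Ycut-unraised k k 0 (λ (r0 , _) → n≮0 (raisable-pos r0))) xc-0
    Yk : Y k ≡ x
    Yk = Ycut-unraised k k k (≺-irrefl ∘ proj₂)
    open LinePath k<n (proj₁ r) steep Y0 Yk Y-below (λ _ j≤n → Ycut≤d k k j≤n) Y-above
      using (module Raising)
    Y′k : Ycut k (suc k) k ≡ suc x
    Y′k = Ycut-raised k (suc k) k (r , inj₂ (refl , ≤-refl))
    unchanged : ∀ j → j ≢ k → Ycut k (suc k) j ≡ Y j
    unchanged j j≢k = cong (xc j +_) (𝟙-cong (raised? k (suc k) j) (raised? k k j) (mk⇔
      (λ (rj , before) → rj , narrow before) (λ (rj , before) → rj , before-widen {k} before)))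
      where
      narrow : Before k (suc k) j → Before k k j
      narrow (inj₁ lt)          = inj₁ lt
      narrow (inj₂ (eq , j<1+k)) = inj₂ (eq , ≤∧≢⇒< (s≤s⁻¹ j<1+k) j≢k)

  Unraised : ℕ → ℕ → ℕ → Set
  Unraised K T j = Raisable j × ¬ Before K T j

  unraised? : ∀ K T j → Dec (Unraised K T j)
  unraised? K T j = raisable? j ×-dec ¬? (before? K T j)

  unraisedCount : ℕ → ℕ → ℕ
  unraisedCount K T = sumTo (λ j → 𝟙 (unraised? K T j)) n

  SegmentRaised : ℕ → ℕ → Set
  SegmentRaised K T = ∀ j → 1 ≤ j → j < n → j * d ≡ n * xc j → Before K T j

  segment-raisable : ∀ {j} → 1 ≤ j → j < n → j * d ≡ n * xc j → Raisable j
  segment-raisable {j} 1≤j j<n eq =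
    *-cancelˡ-< n _ _ (subst (_< n * d) eq (*-monoˡ-< d j<n)) ,
    subst (_< j * suc d) eq
      (subst (j * d <_) (sym (trans (*-suc j d) (+-comm j (j * d)))) (m<m+n (j * d) 1≤j))

  Yfin : ℕ → ℕ
  Yfin j = xc j + 𝟙 (raisable? j)

  Ycut-cong : ∀ {K T K′ T′} → (∀ j → j ≤ n → Raisable j → Before K T j ⇔ Before K′ T′ j) →
              pathWord (Ycut K T) n d ≡ pathWord (Ycut K′ T′) n d
  Ycut-cong {K} {T} {K′} {T′} same = pathWord-cong n d (λ j j≤n → cong (xc j +_)
    (𝟙-cong (raised? K T j) (raised? K′ T′ j)
      (mk⇔ (λ (r , bj) → r , to (same j j≤n r) bj) (λ (r , bj) → r , from (same j j≤n r) bj))))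

  Ycut-final : ∀ {K T} → (∀ j → j < suc n → ¬ Unraised K T j) →
               pathWord (Ycut K T) n d ≡ pathWord Yfin n d
  Ycut-final {K} {T} none = pathWord-cong n d (λ j j≤n → cong (xc j +_) (𝟙-cong (raised? K T j) (raisable? j)
    (mk⇔ proj₁ (λ r → r , decidable-stable (before? K T j) (λ ¬b → none j (s≤s j≤n) (r , ¬b))))))

  cut-at-least : ∀ {K T k} → 1 ≤ K → Unraised K T k → (∀ j → j < suc n → Unraised K T j → ¬ j ≺ k) →
                 ∀ j → j ≤ n → Raisable j → Before K T j ⇔ j ≺ k
  cut-at-least {K} {T} {k} 1≤K (rk , ¬bk) least j j≤n rj = mk⇔ forward backward
    where
    forward : Before K T j → j ≺ k
    forward bj with ≺-trichotomy j k
    ... | inj₁ j≺k        = j≺k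
    ... | inj₂ (inj₁ refl) = ⊥-elim (¬bk bj)
    ... | inj₂ (inj₂ k≺j) = ⊥-elim (¬bk (before-trans 1≤K (raisable-pos rk) (raisable-pos rj) k≺j bj))
    backward : j ≺ k → Before K T j
    backward j≺k = decidable-stable (before? K T j) (λ ¬bj → least j (s≤s j≤n) (rj , ¬bj) j≺k)

  ¬raisable-n : ¬ Raisable n
  ¬raisable-n (xcn<d , _) = <-irrefl xc-n xcn<d

  sweep-step : ∀ {K T} k → 1 ≤ K → SegmentRaised K T → k < suc n → Unraised K T k →
    (∀ j → j < suc n → Unraised K T j → ¬ j ≺ k) →
    m (pathWord (Ycut K T) n d) ≤ m (pathWord (Ycut k (suc k)) n d) ×
    unraisedCount k (suc k) < unraisedCount K T × SegmentRaised k (suc k)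
  sweep-step zero _ _ _ (r0 , _) _ = ⊥-elim (n≮0 (raisable-pos r0))
  sweep-step {K} {T} (suc k′) 1≤K seg k<1+n unr@(rk , ¬bk) least = m-step , fewer , seg′
    where
    k : ℕ
    k = suc k′
    same : ∀ j → j ≤ n → Raisable j → Before K T j ⇔ j ≺ k
    same = cut-at-least 1≤K unr least
    k<n : k < n
    k<n = ≤∧≢⇒< (s≤s⁻¹ k<1+n) (λ { refl → ¬raisable-n rk })
    steep : k * d < n * xc k
    steep = ≤∧≢⇒< (xc-bound k) (λ eq → ¬bk (seg k (s≤s z≤n) k<n eq))
    m-step : m (pathWord (Ycut K T) n d) ≤ m (pathWord (Ycut k (suc k)) n d)
    m-step = ≤-trans (≤-reflexive (cong m (Ycut-cong {K} {T} {k} {k} same))) (m-raise-at k′ k<n rk steep)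
    fewer : unraisedCount k (suc k) < unraisedCount K T
    fewer = <-≤-trans
      (sumTo-mono-< n (s≤s z≤n) (s≤s⁻¹ k<1+n)
        (λ j _ _ → 𝟙-mono (unraised? k (suc k) j) (unraised? k k j)
                            (λ (rj , ¬b) → rj , ¬b ∘ before-widen {k}))
        (subst₂ _<_ (sym (𝟙-no (unraised? k (suc k) k) (λ (_ , ¬b) → ¬b (inj₂ (refl , ≤-refl)))))
                    (sym (𝟙-yes (unraised? k k k) (rk , ≺-irrefl))) ≤-refl))
      (sumTo-mono-≤ n (λ j _ j≤n → 𝟙-mono (unraised? k k j) (unraised? K T j)
        (λ (rj , ¬b) → rj , ¬b ∘ to (same j j≤n rj))))
    seg′ : SegmentRaised k (suc k)
    seg′ j 1≤j j<n eq =
      before-widen {k} (to (same j (<⇒≤ j<n) (segment-raisable 1≤j j<n eq)) (seg j 1≤j j<n eq))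

  sweep : ∀ N K T → 1 ≤ K → SegmentRaised K T → unraisedCount K T ≤ N →
          m (pathWord (Ycut K T) n d) ≤ m (pathWord Yfin n d)
  sweep N K T 1≤K seg count≤N with minimal (suc n)
    where
    open Minimal (unraised? K T) (λ i j → before? j j i) ≺-irrefl
      (λ {_} {_} {l} (ri , _) (rj , _) (rl , _) →
         before-trans {l} {l} (raisable-pos rl) (raisable-pos ri) (raisable-pos rj))
  ... | inj₁ none = ≤-reflexive (cong m (Ycut-final {K} {T} none))
  ... | inj₂ (k , k<1+n , unr , least) with N | sweep-step k 1≤K seg k<1+n unr least
  ...   | zero   | _   , fewer , _    = ⊥-elim (n≮0 (<-≤-trans fewer count≤N))
  ...   | suc N′ | m≤ , fewer , seg′ =
    ≤-trans m≤ (sweep N′ k (suc k) (raisable-pos (proj₁ unr)) seg′ (s≤s⁻¹ (<-≤-trans fewer count≤N)))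

  SegmentRaised-start : SegmentRaised n n
  SegmentRaised-start j _ j<n eq = inj₂ (trans (cong (j *_) xc-n) eq , j<n)

  -- Raising exactly the up steps on the segment reflects c(n,d) through the centre of its box.
  m-start : m (pathWord xc n d) ≡ m (pathWord (Ycut n n) n d)
  m-start = m-pathWord-reflect n′ d {xc} {Ycut n n} xc-0 YH0 (xc-pos ≤-refl)
              (≤-trans (xc-pos ≤-refl) (m≤m+n (xc 1) _)) xc-n YHn antipodal
    where
    open Pivot (s≤s z≤n) ≤-refl (subst (λ x → n * x < n * suc d) (sym xc-n) (*-monoʳ-< n (n<1+n d)))
    YH0 : Ycut n n 0 ≡ 0
    YH0 = trans (Ycut-unraised n n 0 (λ (r0 , _) → n≮0 (raisable-pos r0))) xc-0
    YHn : Ycut n n n ≡ d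
    YHn = trans (Ycut-unraised n n n (¬raisable-n ∘ proj₁)) xc-n
    antipodal : ∀ i j → 1 ≤ i → 1 ≤ j → i + j ≡ n → xc i + Ycut n n j ≡ suc d
    antipodal i j 1≤i 1≤j i+j≡n
      with floor-of {k = n} (λ y → Y-below y 1≤j j<n)
         | ceil-of {k = n} (*-mono-≤ 1≤i (s≤s (z≤n {d′}))) (xc≤⇔ i)
      where
      j<n : j < n
      j<n = subst (j <_) i+j≡n (+-monoˡ-≤ j 1≤i)
    ... | p , Y≡ , np≤ , <np′ | q , xc≡ , nq< , ≤nq′ =
      trans (cong₂ _+_ xc≡ Y≡) (trans (+-comm (suc q) (suc p)) (floor+ceil {k = n} np≤ <np′ nq< ≤nq′ total))
      where
      total : j * xc n + i * d ≡ n * d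
      total = trans (cong (λ x → j * x + i * d) xc-n)
                    (trans (sym (*-distribʳ-+ d j i)) (cong (_* d) (trans (+-comm j i) i+j≡n)))

m-c-n=0 : ∀ d → m (c 0 d) < m (c 0 (suc d))
m-c-n=0 d = subst₂ _<_ (cong m (sym (c≡pathWord 0 d _ flat))) (cong m (sym (c≡pathWord 0 (suc d) _ flat)))
                       (m-insert-a [] (a^ d))
  where
  flat : ∀ {e} j x → j ≤ 0 → 0 ≤ x ⇔ j * e ≤ 0 * x
  flat _ _ z≤n = mk⇔ (λ _ → z≤n) (λ _ → z≤n)

m-c-d=0 : ∀ n′ → m (c (suc n′) 0) < m (c (suc n′) 1)
m-c-d=0 n′ = begin-strict
  m (c n 0)                             ≡⟨ cong m (c≡pathWord n 0 (λ _ → 0) flat) ⟩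
  m (pathWord (λ _ → 0) n 0)            ≡⟨ cong m (pathWord-cong n 0 (λ j _ → sym (⊓-zeroʳ (Up.xc j)))) ⟩
  m (pathWord (λ j → Up.xc j ⊓ 0) n 0)  <⟨ m-pathWord-clip n 0 Up.xc Up.xc-0 (λ i≤j _ → Up.xc-mono i≤j) Up.xc-n ⟩
  m (pathWord Up.xc n 1)                ≡⟨ cong m (c≡pathWord n 1 Up.xc (λ j y _ → Up.xc≤⇔ j y)) ⟨
  m (c n 1)                             ∎
  where
  open ≤-Reasoning
  module Up = Slopes n′ 0
  n : ℕ
  n = suc n′
  flat : ∀ j x → j ≤ n → 0 ≤ x ⇔ j * 0 ≤ n * x
  flat j x _ = mk⇔ (λ _ → subst (_≤ n * x) (sym (*-zeroʳ j)) z≤n) (λ _ → z≤n)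

module _ (n′ d′ : ℕ) where

  open Slopes n′ d′
  private module Up = Slopes n′ (suc d′)

  Up-xc⊓d≡Yfin : ∀ j → j ≤ n → Up.xc j ⊓ d ≡ Yfin j
  Up-xc⊓d≡Yfin j j≤n with raisable? j
  ... | yes (xcj<d , moves) = trans (cong (_⊓ d) up≡) (trans (m≤n⇒m⊓n≡m xcj<d) (+-comm 1 (xc j)))
    where
    open ≤-Reasoning
    up≡ : Up.xc j ≡ suc (xc j)
    up≡ = ≤-antisym (from (Up.xc≤⇔ j (suc (xc j))) (begin
            j * suc d        ≡⟨ *-suc j d ⟩
            j + j * d        ≤⟨ +-mono-≤ j≤n (xc-bound j) ⟩
            n + n * xc j     ≡⟨ *-suc n (xc j) ⟨
            n * suc (xc j)   ∎))
          (≰⇒> (λ up≤xc → <-irrefl refl (<-≤-trans moves (to (Up.xc≤⇔ j (xc j)) up≤xc))))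
  ... | no ¬r = trans min≡ (sym (+-identityʳ (xc j)))
    where
    xc≤up : xc j ≤ Up.xc j
    xc≤up = from (xc≤⇔ j (Up.xc j)) (≤-trans (*-monoʳ-≤ j (n≤1+n d)) (Up.xc-bound j))
    min≡ : Up.xc j ⊓ d ≡ xc j
    min≡ with xc j <? d
    ... | yes xcj<d = trans (cong (_⊓ d) up≡xc) (m≤n⇒m⊓n≡m (<⇒≤ xcj<d))
      where
      up≡xc : Up.xc j ≡ xc j
      up≡xc = ≤-antisym (from (Up.xc≤⇔ j (xc j)) (≮⇒≥ (λ moves → ¬r (xcj<d , moves)))) xc≤up
    ... | no  xcj≮d = trans (m≥n⇒m⊓n≡n (≤-trans (≮⇒≥ xcj≮d) xc≤up)) (≤-antisym (≮⇒≥ xcj≮d) (xc≤d j≤n))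

  m-c-suc-d : m (c n d) < m (c n (suc d))
  m-c-suc-d = begin-strict
    m (c n d)                             ≡⟨ cong m (c≡pathWord n d xc (λ j y _ → xc≤⇔ j y)) ⟩
    m (pathWord xc n d)                   ≡⟨ m-start ⟩
    m (pathWord (Ycut n n) n d)           ≤⟨ sweep _ n n (s≤s z≤n) SegmentRaised-start ≤-refl ⟩
    m (pathWord Yfin n d)                 ≡⟨ cong m (pathWord-cong n d Up-xc⊓d≡Yfin) ⟨
    m (pathWord (λ j → Up.xc j ⊓ d) n d)  <⟨ m-pathWord-clip n d Up.xc Up.xc-0 (λ i≤j _ → Up.xc-mono i≤j) Up.xc-n ⟩
    m (pathWord Up.xc n (suc d))          ≡⟨ cong m (c≡pathWord n (suc d) Up.xc (λ j y _ → Up.xc≤⇔ j y)) ⟨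
    m (c n (suc d))                       ∎
    where open ≤-Reasoning

corollary3p3 : (d n : ℕ) → m (c n d) < m (c n (suc d))
corollary3p3 d        zero     = m-c-n=0 d
corollary3p3 zero     (suc n′) = m-c-d=0 n′
corollary3p3 (suc d′) (suc n′) = m-c-suc-d n′ d′
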